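{- For every $\lambda\in\Lambda_n[\widehat{C_2}]$, Vazirani's idempotent $\mathfrak{g}_\lambda\in{\sf MR}_n[C_2]$ satisfies $$\mathfrak{g}_\lambda=\frac{1}{2^{\ell(\lambda)}\,\ell(\lambda)!}\sum_{\substack{\alpha\in\Gamma_n[\widehat{C_2}]\\ \mathsf{supp}(\alpha)=\lambda}}\ \sum_{\substack{p\in\Gamma_n[C_2]\\ |p|=|\alpha|}}\overline{\alpha(p)}\sum_{\substack{q\in\Gamma_n[C_2]\\ p\le q}}\frac{(-1)^{\ell(q)-\ell(p)}}{\deg(q/p)}X_q.$$
   Context: $C_2=\{\pm1\}$, $\widehat{C_2}=\{\mathbf{trv},\mathbf{sgn}\}$ (trivial and sign characters). $\Gamma_n[C_2]$ (resp. $\Gamma_n[\widehat{C_2}]$) is the set of tuples $((a_1,\epsilon_1),\dots,(a_k,\epsilon_k))$ of positive integers summing to $n$ with labels in $C_2$ (resp. $\widehat{C_2}$); $\ell$ = number of parts; $|p|=(a_1,\dots,a_k)$. $\Lambda_n[\widehat{C_2}]$ is the set of multisets of such labeled parts; $\mathsf{supp}$ forgets the order. For $|p|=|\alpha|$, $\alpha(p)=\prod_i\alpha_i(\epsilon_i)$. $p\le q$ in $\Gamma_n[C_2]$ iff $q$ is obtained by splitting each part of $p$ into consecutive parts with the same label; if the $i$-th part is split into $d_i$ parts, $\deg(q/p)=\prod_i d_i$. Wreath product $\mathfrak{S}_n[C_2]$: elements $((\sigma_1,g_1),\dots,(\sigma_n,g_n))$, product $((\sigma_i,g_i))\cdot((\tau_i,h_i))=((\sigma_{\tau_i},g_{\tau_i}h_i))_i$.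 $\mathrm{co}(\sigma,g)$ is the coarsest $((a_i,h_i))\in\Gamma_n[C_2]$ such that on consecutive position segments of lengths $a_1,a_2,\dots$ the $\sigma_j$ increase and the $g_j$ equal $h_i$. $Y_p=\sum_{\mathrm{co}(\sigma,g)=p}(\sigma,g)$, $X_p=\sum_{q\le p}Y_q$, ${\sf MR}_n[C_2]=\mathrm{span}\{X_p\}$. Star product on $\bigoplus_n\mathbb{C}\mathfrak{S}_n[C_2]$: for $u=(\sigma,g)\in\mathfrak{S}_n[C_2]$, $v=(\tau,h)\in\mathfrak{S}_m[C_2]$, $u\times v=((\sigma_1,g_1),\dots,(\sigma_n,g_n),(n+\tau_1,h_1),\dots,(n+\tau_m,h_m))$ and $u\star v=\sum_{w\in{\sf Sh}(n,m)}(w,(1,\dots,1))\cdot(u\times v)$, where ${\sf Sh}(n,m)=\{w\in\mathfrak{S}_{n+m}:w_1<\dots<w_n,\ w_{n+1}<\dots<w_{n+m}\}$. $r_a=\sum_p\frac{(-1)^{\ell(p)-1}}{\ell(p)}X_p$ over $p\in\Gamma_a[C_2]$ with all labels $+1$; $\overline{r_a}$ is the same sum with all labels $-1$. $\mathcal{I}_{(a,\mathbf{trv})}=\frac12(r_a+\overline{r_a})$, $\mathcal{I}_{(a,\mathbf{sgn})}=\frac12(r_a-\overline{r_a})$, $\mathcal{I}_\alpha=\mathcal{I}_{\alpha_1}\star\cdots\star\mathcal{I}_{\alpha_k}$. Vazirani's idempotents: $\mathfrak{g}_\lambda=\frac{1}{\ell(\lambda)!}\sum_{\mathsf{supp}(\alpha)=\lambda}\mathcal{I}_\alpha$.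 -}

module Defs where

open import Data.Bool using (Bool; true; false; if_then_else_; _∧_)
open import Data.Nat as ℕ using (ℕ; zero; suc; _∸_; _<ᵇ_; _≡ᵇ_; _≤ᵇ_; _!; _^_)
open import Data.Integer using (ℤ; +_; -[1+_])
open import Data.Rational using (ℚ; 0ℚ; 1ℚ; _+_; _*_; -_; _/_)
open import Data.List using (List; []; _∷_; _++_; map; concat; concatMap; length; upTo; zip; foldr; replicate)
open import Data.Nat.ListAction using (sum)
open import Data.List.Relation.Unary.All using (All)
open import Data.List.Properties as LP using ()
open import Data.Product using (_×_; _,_; proj₁; proj₂)
open import Data.Product.Properties as PP using ()
open import Data.Maybe using (Maybe; just; nothing)
open import Relation.Nullary using (Dec; yes; no; does)
open import Relation.Binary.PropositionalEquality using (_≡_; refl)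
open import Relation.Binary.Definitions using (DecidableEquality)

filter : {A : Set} → (A → Bool) → List A → List A
filter f [] = []
filter f (x ∷ xs) = if f x then x ∷ filter f xs else filter f xs

all : {A : Set} → (A → Bool) → List A → Bool
all f [] = true
all f (x ∷ xs) = f x ∧ all f xs

data C2 : Set where
  plus minus : C2

data C2^ : Set where
  trv sgn : C2^

_≟C_ : DecidableEquality C2
plus ≟C plus = yes refl
plus ≟C minus = no (λ ())
minus ≟C plus = no (λ ())
minus ≟C minus = yes refl

_≟C^_ : DecidableEquality C2^
trv ≟C^ trv = yes refl
trv ≟C^ sgn = no (λ ())
sgn ≟C^ trv = no (λ ())
sgn ≟C^ sgn = yes refl

allC2 : List C2
allC2 = plus ∷ minus ∷ []

allC2^ : List C2^
allC2^ = trv ∷ sgn ∷ []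

chi : C2^ → C2 → ℚ
chi trv _ = 1ℚ
chi sgn plus = 1ℚ
chi sgn minus = - 1ℚ

-- 1/k for k ≥ 1 (only ever applied to nonzero k)
invℕ : ℕ → ℚ
invℕ zero = 0ℚ
invℕ (suc k) = + 1 / suc k

negOnePow : ℕ → ℚ
negOnePow zero = 1ℚ
negOnePow (suc k) = - negOnePow k

-- Labeled compositions Γₙ[L]: lists ((a₁,ε₁),…,(a_k,ε_k)), aᵢ ≥ 1, Σ aᵢ = n

Comp : Set → Set
Comp L = List (ℕ × L)

compsAux : {L : Set} → List L → ℕ → ℕ → List (Comp L)
compsAux ls fuel zero = [] ∷ []
compsAux ls zero (suc m) = []
compsAux ls (suc fuel) (suc m) =
  concatMap (λ a → concatMap (λ e →
     map (λ rest → (suc a , e) ∷ rest) (compsAux ls fuel (m ∸ a))) ls)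
   (upTo (suc m))

Γ : {L : Set} → List L → ℕ → List (Comp L)
Γ ls n = compsAux ls n n

IsComp : {L : Set} → ℕ → Comp L → Set
IsComp n p = All (λ x → 1 ℕ.≤ proj₁ x) p × sum (map proj₁ p) ≡ n

shape : {L : Set} → Comp L → List ℕ
shape p = map proj₁ p

decC2 : DecidableEquality (ℕ × C2)
decC2 = PP.≡-dec ℕ._≟_ _≟C_

decC2^ : DecidableEquality (ℕ × C2^)
decC2^ = PP.≡-dec ℕ._≟_ _≟C^_

-- supp: multiset of labeled parts. supp α = supp β iff every labeled part
-- occurs equally often in α and β.

count : (ℕ × C2^) → Comp C2^ → ℕ
count x [] = 0
count x (y ∷ ys) = if does (decC2^ x y) then suc (count x ys) else count x ys

sameSupp : Comp C2^ → Comp C2^ → Bool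
sameSupp a b = all (λ x → count x a ≡ᵇ count x b) (a ++ b)

evalChar : Comp C2^ → Comp C2 → ℚ
evalChar ((_ , c) ∷ α) ((_ , e) ∷ p) = chi c e * evalChar α p
evalChar _ _ = 1ℚ

-- Refinement order on Γₙ[C₂] with degree.
-- refineDeg p q = just deg(q/p) if p ≤ q (q obtained by splitting each part
-- of p into consecutive parts with the same label), nothing otherwise.

-- consume from q parts labeled e summing exactly to a; return (#parts, rest)
takeSum : ℕ → C2 → Comp C2 → Maybe (ℕ × Comp C2)
takeSum a e [] = nothing
takeSum a e ((b , h) ∷ q) with does (e ≟C h) ∧ (b ≤ᵇ a) ∧ (1 ≤ᵇ b)
... | false = nothing
... | true with b ≡ᵇ a
...   | true = just (1 , q)
...   | false with takeSum (a ∸ b) e q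
...     | nothing = nothing
...     | just (d , r) = just (suc d , r)

refineDeg : Comp C2 → Comp C2 → Maybe ℕ
refineDeg [] [] = just 1
refineDeg [] (_ ∷ _) = nothing
refineDeg ((a , e) ∷ p) q with takeSum a e q
... | nothing = nothing
... | just (d , r) with refineDeg p r
...   | nothing = nothing
...   | just D = just (d ℕ.* D)

_≤Γ_ : Comp C2 → Comp C2 → Bool
p ≤Γ q with refineDeg p q
... | nothing = false
... | just _ = true

-- Hyperoctahedral group 𝔖ₙ[C₂]: words ((σ₁,g₁),…,(σₙ,gₙ)), σ a
-- permutation of 1..n (values 1-based), gᵢ ∈ C₂.

Word : Set
Word = List (ℕ × C2)

_≟W_ : DecidableEquality Word
_≟W_ = LP.≡-dec decC2

inserts : ℕ → List ℕ → List (List ℕ)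
inserts x [] = (x ∷ []) ∷ []
inserts x (y ∷ ys) = (x ∷ y ∷ ys) ∷ map (y ∷_) (inserts x ys)

perms : List ℕ → List (List ℕ)
perms [] = [] ∷ []
perms (x ∷ xs) = concatMap (inserts x) (perms xs)

signVecs : ℕ → List (List C2)
signVecs zero = [] ∷ []
signVecs (suc n) = concatMap (λ g → map (g ∷_) (signVecs n)) allC2

elems : ℕ → List Word
elems n = concatMap (λ σ → map (zip σ) (signVecs n)) (perms (map suc (upTo n)))

-- co(σ,g): coarsest labeled composition with σ increasing and g constant
-- on the segments
coGo : ℕ → C2 → ℕ → Word → Comp C2
coGo x g k [] = (k , g) ∷ []
coGo x g k ((y , h) ∷ w) =
  if (x <ᵇ y) ∧ does (g ≟C h) then coGo y g (suc k) w
  else (k , g) ∷ coGo y h 1 w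

co : Word → Comp C2
co [] = []
co ((x , g) ∷ w) = coGo x g 1 w

-- Group algebra ℚ𝔖[C₂] (all degrees): finite formal linear combinations,
-- compared by their coefficient functions.

Alg : Set
Alg = List (ℚ × Word)

coeff : Alg → Word → ℚ
coeff [] w = 0ℚ
coeff ((c , u) ∷ A) w = if does (u ≟W w) then c + coeff A w else coeff A w

_≈A_ : Alg → Alg → Set
A ≈A B = ∀ w → coeff A w ≡ coeff B w

scale : ℚ → Alg → Alg
scale c A = map (λ x → (c * proj₁ x , proj₂ x)) A

unitA : Alg
unitA = (1ℚ , []) ∷ []

Y : ℕ → Comp C2 → Alg
Y n p = map (λ w → (1ℚ , w)) (filter (λ w → does (LP.≡-dec (PP.≡-dec ℕ._≟_ _≟C_) (co w) p)) (elems n))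

X : ℕ → Comp C2 → Alg
X n p = concatMap (Y n) (filter (λ q → q ≤Γ p) (Γ allC2 n))

masks : ℕ → ℕ → List (List Bool)
masks zero m = replicate m false ∷ []
masks (suc n) zero = replicate (suc n) true ∷ []
masks (suc n) (suc m) = map (true ∷_) (masks n (suc m)) ++ map (false ∷_) (masks (suc n) m)

positions : Bool → ℕ → List Bool → List ℕ
positions b i [] = []
positions b i (c ∷ cs) = if does (Data.Bool._≟_ b c) then i ∷ positions b (suc i) cs else positions b (suc i) cs
  where import Data.Bool

-- Sh(n,m) as one-line notations w₁…w_{n+m} (values 1-based)
shuffles : ℕ → ℕ → List (List ℕ)
shuffles n m = map (λ b → positions true 1 b ++ positions false 1 b) (masks n m)

-- w_j (1-based)
at : List ℕ → ℕ → ℕ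
at [] j = 0
at (x ∷ xs) zero = 0
at (x ∷ xs) (suc zero) = x
at (x ∷ xs) (suc (suc j)) = at xs (suc j)

cross : Word → Word → Word
cross u v = u ++ map (λ x → (length u ℕ.+ proj₁ x , proj₂ x)) v

-- (w,(1,…,1)) · x = ((w_{xᵢ}, hᵢ))ᵢ
actL : List ℕ → Word → Word
actL w x = map (λ y → (at w (proj₁ y) , proj₂ y)) x

starW : Word → Word → Alg
starW u v = map (λ w → (1ℚ , actL w (cross u v))) (shuffles (length u) (length v))

_⋆_ : Alg → Alg → Alg
A ⋆ B = concatMap (λ a → concatMap (λ b → scale (proj₁ a * proj₁ b) (starW (proj₂ a) (proj₂ b))) B) A

allLabel : C2 → Comp C2 → Bool
allLabel e p = all (λ x → does (e ≟C proj₂ x)) p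

-- r_a (e = plus) and r̄_a (e = minus)
rr : C2 → ℕ → Alg
rr e a = concatMap (λ p → scale (negOnePow (length p ∸ 1) * invℕ (length p)) (X a p))
           (filter (allLabel e) (Γ allC2 a))

Ipart : ℕ × C2^ → Alg
Ipart (a , trv) = scale (+ 1 / 2) (rr plus a ++ rr minus a)
Ipart (a , sgn) = scale (+ 1 / 2) (rr plus a ++ scale (- 1ℚ) (rr minus a))

Iα : Comp C2^ → Alg
Iα α = foldr (λ x acc → Ipart x ⋆ acc) unitA α

-- 𝔤_λ, with λ given by any list representing the multiset
vazirani : ℕ → Comp C2^ → Alg
vazirani n lm = scale (invℕ (length lm !)) (concatMap Iα (filter (sameSupp lm) (Γ allC2^ n)))

rhs : ℕ → Comp C2^ → Alg
rhs n lm =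
  scale (invℕ (2 ^ length lm ℕ.* length lm !))
    (concatMap (λ α →
       concatMap (λ p →
         scale (evalChar α p)
           (concatMap (λ q → inner p q (refineDeg p q)) (Γ allC2 n)))
       (filter (λ p → does (LP.≡-dec ℕ._≟_ (shape p) (shape α))) (Γ allC2 n)))
     (filter (sameSupp lm) (Γ allC2^ n)))
  where
  inner : Comp C2 → Comp C2 → Maybe ℕ → Alg
  inner p q nothing = []
  inner p q (just d) = scale (negOnePow (length q ∸ length p) * invℕ d) (X n q)

-- Expanding Y_p and X_p over the hyperoctahedral group, a signed permutation w contributes to X_p exactly when
-- co(w) ≤ p, i.e. when w, cut into segments of lengths p₁, p₂, …, is increasing with constant sign εᵢ on the i-th
-- segment. The terms of u ⋆ v are the shuffles of u and v; a shuffle keeps the relative order inside each factor,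
-- so it satisfies this condition for p ++ q iff u does for p and v does for q, and shuffling is a bijection from
-- masks × 𝔖ₙ[C₂] × 𝔖ₘ[C₂] onto 𝔖ₙ₊ₘ[C₂]. Hence X_p ⋆ X_q = X_{p++q}.
-- By induction on ℓ(α), 𝓘_α = 𝓘_{α₁} ⋆ 𝓘_α' is then a sum of terms X_{q₁ ++ q} with q₁ a monochrome composition
-- of α₁, weighted by ½ α₁(ε) (−1)^(ℓ(q₁)−1)/ℓ(q₁). Regrouping them by the coarsening p that merges q₁ into a single
-- part gives 𝓘_α = 2^(−ℓ(α)) ∑_p α(p) ∑_{p≤q} (−1)^(ℓ(q)−ℓ(p))/deg(q/p) X_q, and summing over the α with
-- supp α = λ, which all have length ℓ(λ), gives the corollary.

module Submission where

open import Defs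
open import Data.Bool using (Bool; true; false; if_then_else_; _∧_; T)
open import Data.Bool.Properties using (∧-assoc)
open import Data.Nat as ℕ using (ℕ; zero; suc; _∸_; _≤_; _<_; z≤n; s≤s; _<ᵇ_; _≤ᵇ_; _≡ᵇ_; _!; _^_)
import Data.Nat.Properties as NP
open import Data.Nat.ListAction using (sum)
import Data.Nat.Tactic.RingSolver as NS
import Data.Integer as ℤ
open import Data.Rational using (ℚ; 0ℚ; 1ℚ; _+_; _*_; -_; _/_)
import Data.Rational.Properties as QP
import Data.Rational.Unnormalised as U
import Data.Rational.Unnormalised.Properties as UP
open import Data.List using (List; []; _∷_; _++_; map; concatMap; concat; length; upTo; applyUpTo; zip; take; drop; replicate; deduplicate; _∷ʳ_)
import Data.List.Properties as LP
open import Data.List.Relation.Unary.Any using (here; there)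
open import Data.List.Relation.Unary.All as All using (All)
open import Data.List.Membership.Propositional using (_∈_; _∉_; find)
open import Data.List.Membership.Propositional.Properties using (∈-map⁺; ∈-map⁻; ∈-++⁺ˡ; ∈-++⁺ʳ; ∈-++⁻; ∈-concatMap⁻; ∈-concat⁺′; ∈-upTo⁺; ∈-upTo⁻; ∈-∃++; ∈-deduplicate⁺)
open import Data.List.Relation.Binary.Permutation.Propositional using (_↭_; ↭-sym; ↭-refl; ↭-trans; prep; swap; ↭-reflexive)
import Data.List.Relation.Binary.Permutation.Propositional.Properties as PermP
open import Data.Product using (_×_; _,_; proj₁; proj₂; map₁; Σ; ∃)
open import Data.Sum using (inj₁; inj₂)
open import Data.Maybe as Maybe using (Maybe; just; nothing; is-just)
open import Data.Empty using (⊥; ⊥-elim)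
open import Data.Unit using (⊤; tt)
open import Data.List.Relation.Unary.AllPairs using (AllPairs; []; _∷_)
open import Data.List.Relation.Unary.Unique.Propositional using (Unique)
import Data.List.Relation.Unary.Unique.Propositional.Properties as UniqueP
open import Data.List.Relation.Unary.Unique.DecPropositional.Properties _≟W_ using (deduplicate-!)
open import Data.List.Membership.DecPropositional _≟W_ using () renaming (_∈?_ to _∈W?_)
open import Data.List.Relation.Unary.All.Properties using (All¬⇒¬Any; ¬Any⇒All¬)
open import Relation.Nullary using (yes; no; does; ¬_)
open import Relation.Nullary.Decidable using (dec-true; dec-false; toSum)
open import Relation.Binary.PropositionalEquality
open import Relation.Binary.Definitions using (DecidableEquality; Tri; tri<; tri≈; tri>)
open import Tactic.RingSolver using (solve-∀)
open import Tactic.RingSolver.Core.AlmostCommutativeRing using (AlmostCommutativeRing; fromCommutativeRing)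
open ≡-Reasoning

ℚ-ring : AlmostCommutativeRing _ _
ℚ-ring = fromCommutativeRing QP.+-*-commutativeRing (λ _ → nothing)

∑ : {A : Set} → (A → ℚ) → List A → ℚ
∑ f [] = 0ℚ
∑ f (x ∷ xs) = f x + ∑ f xs

𝟙 : Bool → ℚ
𝟙 true = 1ℚ
𝟙 false = 0ℚ

+-interchange : ∀ (a b c d : ℚ) → (a + b) + (c + d) ≡ (a + c) + (b + d)
+-interchange = solve-∀ ℚ-ring

module _ {A : Set} where
  ∑-++ : (f : A → ℚ) (xs ys : List A) → ∑ f (xs ++ ys) ≡ ∑ f xs + ∑ f ys
  ∑-++ f [] ys = sym (QP.+-identityˡ _)
  ∑-++ f (x ∷ xs) ys = trans (cong (f x +_) (∑-++ f xs ys)) (sym (QP.+-assoc (f x) (∑ f xs) (∑ f ys)))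

  ∑-cong : {f g : A → ℚ} → (∀ x → f x ≡ g x) → (xs : List A) → ∑ f xs ≡ ∑ g xs
  ∑-cong e [] = refl
  ∑-cong e (x ∷ xs) = cong₂ _+_ (e x) (∑-cong e xs)

  ∑-cong-∈ : {f g : A → ℚ} (xs : List A) → (∀ {x} → x ∈ xs → f x ≡ g x) → ∑ f xs ≡ ∑ g xs
  ∑-cong-∈ [] e = refl
  ∑-cong-∈ (x ∷ xs) e = cong₂ _+_ (e (here refl)) (∑-cong-∈ xs (λ m → e (there m)))

  ∑-+ : (f g : A → ℚ) (xs : List A) → ∑ (λ x → f x + g x) xs ≡ ∑ f xs + ∑ g xs
  ∑-+ f g [] = sym (QP.+-identityʳ _)
  ∑-+ f g (x ∷ xs) = trans (cong (f x + g x +_) (∑-+ f g xs)) (+-interchange (f x) (g x) (∑ f xs) (∑ g xs))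

  ∑-*ˡ : (c : ℚ) (f : A → ℚ) (xs : List A) → ∑ (λ x → c * f x) xs ≡ c * ∑ f xs
  ∑-*ˡ c f [] = sym (QP.*-zeroʳ c)
  ∑-*ˡ c f (x ∷ xs) = trans (cong (c * f x +_) (∑-*ˡ c f xs)) (sym (QP.*-distribˡ-+ c (f x) (∑ f xs)))

  ∑-0 : (xs : List A) → ∑ (λ _ → 0ℚ) xs ≡ 0ℚ
  ∑-0 [] = refl
  ∑-0 (x ∷ xs) = trans (QP.+-identityˡ _) (∑-0 xs)

  ∑-zero : {f : A → ℚ} → (∀ x → f x ≡ 0ℚ) → (xs : List A) → ∑ f xs ≡ 0ℚ
  ∑-zero e xs = trans (∑-cong e xs) (∑-0 xs)

  ∑-filter : (b : A → Bool) (f : A → ℚ) (xs : List A) → ∑ f (filter b xs) ≡ ∑ (λ x → 𝟙 (b x) * f x) xs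
  ∑-filter b f [] = refl
  ∑-filter b f (x ∷ xs) with b x
  ... | true = cong₂ _+_ (sym (QP.*-identityˡ (f x))) (∑-filter b f xs)
  ... | false = trans (∑-filter b f xs) (sym (trans (cong (_+ ∑ (λ x → 𝟙 (b x) * f x) xs) (QP.*-zeroˡ (f x))) (QP.+-identityˡ (∑ (λ x → 𝟙 (b x) * f x) xs))))

module _ {A B : Set} where
  ∑-map : (f : B → ℚ) (g : A → B) (xs : List A) → ∑ f (map g xs) ≡ ∑ (λ x → f (g x)) xs
  ∑-map f g [] = refl
  ∑-map f g (x ∷ xs) = cong (f (g x) +_) (∑-map f g xs)

  ∑-concatMap : (f : B → ℚ) (g : A → List B) (xs : List A) → ∑ f (concatMap g xs) ≡ ∑ (λ x → ∑ f (g x)) xs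
  ∑-concatMap f g [] = refl
  ∑-concatMap f g (x ∷ xs) = trans (∑-++ f (g x) (concatMap g xs)) (cong (∑ f (g x) +_) (∑-concatMap f g xs))

  ∑-swap : (f : A → B → ℚ) (xs : List A) (ys : List B) →
    ∑ (λ x → ∑ (f x) ys) xs ≡ ∑ (λ y → ∑ (λ x → f x y) xs) ys
  ∑-swap f [] ys = sym (∑-0 ys)
  ∑-swap f (x ∷ xs) ys = trans (cong (∑ (f x) ys +_) (∑-swap f xs ys)) (sym (∑-+ (f x) (λ y → ∑ (λ x → f x y) xs) ys))

invℕ-*-suc : (a b : ℕ) → invℕ (suc a) * invℕ (suc b) ≡ invℕ (suc a ℕ.* suc b)
invℕ-*-suc a b = QP.toℚᵘ-injective (UP.≃-trans (QP.toℚᵘ-homo-* (invℕ (suc a)) (invℕ (suc b)))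
  (UP.≃-trans (UP.*-cong (QP.toℚᵘ-fromℚᵘ (U.mkℚᵘ (ℤ.+ 1) a)) (QP.toℚᵘ-fromℚᵘ (U.mkℚᵘ (ℤ.+ 1) b)))
   (UP.≃-sym (QP.toℚᵘ-fromℚᵘ (U.mkℚᵘ (ℤ.+ 1) (ℕ.pred (suc a ℕ.* suc b)))))))

invℕ-* : (x y : ℕ) → 1 ≤ x → 1 ≤ y → invℕ x * invℕ y ≡ invℕ (x ℕ.* y)
invℕ-* (suc a) (suc b) _ _ = invℕ-*-suc a b

negOnePow-+ : (x y : ℕ) → negOnePow (x ℕ.+ y) ≡ negOnePow x * negOnePow y
negOnePow-+ zero y = sym (QP.*-identityˡ _)
negOnePow-+ (suc x) y = trans (cong -_ (negOnePow-+ x y)) (QP.neg-distribˡ-* (negOnePow x) (negOnePow y))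

∑-upTo-truncate : (f : ℕ → ℚ) (a K : ℕ) → a ≤ K → (∀ b → a ≤ b → f b ≡ 0ℚ) → ∑ f (upTo K) ≡ ∑ f (upTo a)
∑-upTo-truncate f a zero z≤n z = refl
∑-upTo-truncate f a (suc K) le z with a ℕ.≟ suc K
... | yes refl = refl
... | no ne = begin
  ∑ f (upTo (suc K)) ≡⟨ cong (∑ f) (sym (LP.upTo-∷ʳ K)) ⟩
  ∑ f (upTo K ∷ʳ K) ≡⟨ ∑-++ f (upTo K) (K ∷ []) ⟩
  ∑ f (upTo K) + (f K + 0ℚ) ≡⟨ cong (λ t → ∑ f (upTo K) + (t + 0ℚ)) (z K le') ⟩
  ∑ f (upTo K) + (0ℚ + 0ℚ) ≡⟨ QP.+-identityʳ _ ⟩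
  ∑ f (upTo K) ≡⟨ ∑-upTo-truncate f a K le' z ⟩
  ∑ f (upTo a) ∎
  where
  open ≡-Reasoning
  le' : a ≤ K
  le' = NP.≤-pred (NP.≤∧≢⇒< le ne)

∑-allC2 : (f : C2 → ℚ) → ∑ f allC2 ≡ f plus + f minus
∑-allC2 f = cong (λ t → f plus + t) (QP.+-identityʳ (f minus))

∉⇒unique-∷ : {A : Set} {x : A} {xs : List A} → x ∉ xs → Unique xs → Unique (x ∷ xs)
∉⇒unique-∷ x∉xs u = ¬Any⇒All¬ _ x∉xs ∷ u

unique-head : {A : Set} {x : A} {xs : List A} → Unique (x ∷ xs) → x ∉ xs
unique-head (x≢xs ∷ _) = All¬⇒¬Any x≢xs

unique-tail : {A : Set} {x : A} {xs : List A} → Unique (x ∷ xs) → Unique xs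
unique-tail (_ ∷ u) = u

module _ {A : Set} (_≟_ : DecidableEquality A) where

  ∑-select-∉ : (g : A → ℚ) (x : A) (S : List A) → x ∉ S → ∑ (λ v → if does (x ≟ v) then g v else 0ℚ) S ≡ 0ℚ
  ∑-select-∉ g x [] n = refl
  ∑-select-∉ g x (y ∷ S) n with x ≟ y
  ... | yes refl = ⊥-elim (n (here refl))
  ... | no _ = trans (QP.+-identityˡ _) (∑-select-∉ g x S (λ m → n (there m)))

  ∑-select-∈ : (g : A → ℚ) (x : A) (S : List A) → Unique S → x ∈ S → ∑ (λ v → if does (x ≟ v) then g v else 0ℚ) S ≡ g x
  ∑-select-∈ g x (y ∷ S) u m with x ≟ y
  ... | yes refl = trans (cong (g x +_) (∑-select-∉ g x S (unique-head u))) (QP.+-identityʳ (g x))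
  ∑-select-∈ g x (y ∷ S) u (here e) | no ne = ⊥-elim (ne e)
  ∑-select-∈ g x (y ∷ S) u (there m) | no ne = trans (QP.+-identityˡ _) (∑-select-∈ g x S (unique-tail u) m)

module _ {A : Set} where
  ∈-filter⁻ : (b : A → Bool) {y : A} (L : List A) → y ∈ filter b L → (y ∈ L) × (b y ≡ true)
  ∈-filter⁻ b (x ∷ L) m with b x in eq
  ∈-filter⁻ b (x ∷ L) (here refl) | true = here refl , eq
  ∈-filter⁻ b (x ∷ L) (there m) | true = let r = ∈-filter⁻ b L m in there (proj₁ r) , proj₂ r
  ∈-filter⁻ b (x ∷ L) m | false = let r = ∈-filter⁻ b L m in there (proj₁ r) , proj₂ r

module _ {A B : Set} where
  ∈-concatMap⁻′ : {f : A → List B} {y : B} (xs : List A) → y ∈ concatMap f xs → ∃ λ x → x ∈ xs × y ∈ f x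
  ∈-concatMap⁻′ xs m = find (∈-concatMap⁻ _ m)

  ∈-concatMap⁺′ : {f : A → List B} {x : A} {y : B} {xs : List A} → x ∈ xs → y ∈ f x → y ∈ concatMap f xs
  ∈-concatMap⁺′ {f} mx my = ∈-concat⁺′ my (∈-map⁺ f mx)

  unique-map-∈ : (f : A → B) {xs : List A} → (∀ {x y} → x ∈ xs → y ∈ xs → f x ≡ f y → x ≡ y) → Unique xs → Unique (map f xs)
  unique-map-∈ f {[]} inj u = []
  unique-map-∈ f {x ∷ xs} inj u =
    ∉⇒unique-∷ (λ m → let (y , my , e) = ∈-map⁻ f m in unique-head u (subst (_∈ xs) (sym (inj (here refl) (there my) e)) my))
      (unique-map-∈ f (λ a b e → inj (there a) (there b) e) (unique-tail u))

  unique-concatMap : (f : A → List B) {xs : List A} → Unique xs → (∀ {x} → x ∈ xs → Unique (f x)) →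
    (∀ {x y z} → x ∈ xs → y ∈ xs → z ∈ f x → z ∈ f y → x ≡ y) → Unique (concatMap f xs)
  unique-concatMap f {[]} u uf d = []
  unique-concatMap f {x ∷ xs} u uf d =
    UniqueP.++⁺ (uf (here refl)) (unique-concatMap f (unique-tail u) (λ m → uf (there m)) (λ a b c e → d (there a) (there b) c e))
      (λ (mz , mz') → let (y , my , mzy) = ∈-concatMap⁻′ xs mz' in unique-head u (subst (_∈ xs) (sym (d (here refl) (there my) mz mzy)) my))

module _ {A : Set} (_≟_ : DecidableEquality A) where
  open import Data.List.Membership.DecPropositional _≟_ using (_∈?_)

  removeFirst : A → List A → List A
  removeFirst y [] = []
  removeFirst y (x ∷ xs) with y ≟ x
  ... | yes _ = xs
  ... | no _ = x ∷ removeFirst y xs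

  length-removeFirst : (y : A) (L : List A) → y ∈ L → suc (length (removeFirst y L)) ≡ length L
  length-removeFirst y (x ∷ xs) m with y ≟ x
  ... | yes _ = refl
  length-removeFirst y (x ∷ xs) (here e) | no ne = ⊥-elim (ne e)
  length-removeFirst y (x ∷ xs) (there m) | no ne = cong suc (length-removeFirst y xs m)

  ∈-removeFirst : (y : A) (L : List A) {z : A} → z ∈ L → z ≢ y → z ∈ removeFirst y L
  ∈-removeFirst y (x ∷ xs) {z} m ne with y ≟ x
  ∈-removeFirst y (x ∷ xs) (here refl) ne | yes refl = ⊥-elim (ne refl)
  ∈-removeFirst y (x ∷ xs) (there m) ne | yes refl = m
  ∈-removeFirst y (x ∷ xs) (here refl) ne | no _ = here refl
  ∈-removeFirst y (x ∷ xs) (there m) ne | no _ = there (∈-removeFirst y xs m ne)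

  unique-⊆⇒length-≤ : (L1 L2 : List A) → Unique L1 → (∀ {x} → x ∈ L1 → x ∈ L2) → length L1 ≤ length L2
  unique-⊆⇒length-≤ [] L2 _ _ = z≤n
  unique-⊆⇒length-≤ (y ∷ L1) L2 u sub =
    NP.≤-trans (s≤s (unique-⊆⇒length-≤ L1 (removeFirst y L2) (unique-tail u) (λ {x} m → ∈-removeFirst y L2 (sub (there m)) (λ e → unique-head u (subst (_∈ L1) e m)))))
               (NP.≤-reflexive (length-removeFirst y L2 (sub (here refl))))

  unique-⊆-length-≥⇒⊇ : (L1 L2 : List A) → Unique L1 → (∀ {x} → x ∈ L1 → x ∈ L2) → length L2 ≤ length L1 → ∀ {x} → x ∈ L2 → x ∈ L1
  unique-⊆-length-≥⇒⊇ L1 L2 u1 sub le {x} m with x ∈? L1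
  ... | yes m1 = m1
  ... | no nm = ⊥-elim (NP.<-irrefl refl (NP.≤-trans (s≤s (unique-⊆⇒length-≤ L1 (removeFirst x L2) u1 (λ {z} mz → ∈-removeFirst x L2 (sub mz) (λ e → nm (subst (_∈ L1) e mz)))))
                         (NP.≤-trans (NP.≤-reflexive (length-removeFirst x L2 m)) le)))

++-split : {A : Set} (a a' b b' : List A) → length a ≡ length a' → a ++ b ≡ a' ++ b' → (a ≡ a') × (b ≡ b')
++-split [] [] b b' _ e = refl , e
++-split (x ∷ a) (y ∷ a') b b' l e with LP.∷-injective e
... | refl , e' = let (r1 , r2) = ++-split a a' b b' (NP.suc-injective l) e' in cong (x ∷_) r1 , r2

map-injective-∈ : {A B : Set} (f : A → B) (L L' : List A) → (∀ {x y} → x ∈ L → y ∈ L' → f x ≡ f y → x ≡ y) → map f L ≡ map f L' → L ≡ L'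
map-injective-∈ f [] [] inj e = refl
map-injective-∈ f (x ∷ L) (y ∷ L') inj e with LP.∷-injective e
... | e1 , e2 = cong₂ _∷_ (inj (here refl) (here refl) e1) (map-injective-∈ f L L' (λ a b → inj (there a) (there b)) e2)

∑-single : {A : Set} (_≟_ : DecidableEquality A) (f : A → ℚ) (x : A) (L : List A) → Unique L → x ∈ L → (∀ y → y ≢ x → f y ≡ 0ℚ) → ∑ f L ≡ f x
∑-single _≟_ f x L u m z = trans (∑-cong pt L) (∑-select-∈ _≟_ f x L u m)
  where
  pt : ∀ y → f y ≡ (if does (x ≟ y) then f y else 0ℚ)
  pt y with x ≟ y
  ... | yes _ = refl
  ... | no ne = z y (λ e → ne (sym e))

lin : (Word → ℚ) → Alg → ℚ
lin F A = ∑ (λ t → proj₁ t * F (proj₂ t)) A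

lin-++ : (F : Word → ℚ) (A B : Alg) → lin F (A ++ B) ≡ lin F A + lin F B
lin-++ F A B = ∑-++ _ A B

lin-scale : (F : Word → ℚ) (c : ℚ) (A : Alg) → lin F (scale c A) ≡ c * lin F A
lin-scale F c A = trans (∑-map _ _ A) (trans (∑-cong (λ t → QP.*-assoc c (proj₁ t) (F (proj₂ t))) A) (∑-*ˡ c _ A))

lin-concatMap : {X : Set} (F : Word → ℚ) (g : X → Alg) (xs : List X) → lin F (concatMap g xs) ≡ ∑ (λ x → lin F (g x)) xs
lin-concatMap F g xs = ∑-concatMap _ g xs

lin-units : (F : Word → ℚ) (L : List Word) → lin F (map (λ w → (1ℚ , w)) L) ≡ ∑ F L
lin-units F L = trans (∑-map _ _ L) (∑-cong (λ w → QP.*-identityˡ (F w)) L)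

δ : Word → Word → ℚ
δ w u = 𝟙 (does (u ≟W w))

coeff≡lin-δ : (A : Alg) (w : Word) → coeff A w ≡ lin (δ w) A
coeff≡lin-δ [] w = refl
coeff≡lin-δ ((c , u) ∷ A) w with does (u ≟W w)
... | true = cong₂ _+_ (sym (QP.*-identityʳ c)) (coeff≡lin-δ A w)
... | false = trans (coeff≡lin-δ A w) (sym (trans (cong (_+ lin (δ w) A) (QP.*-zeroʳ c)) (QP.+-identityˡ (lin (δ w) A))))

coeff-⋆ : (A B : Alg) (w : Word) →
  coeff (A ⋆ B) w ≡ lin (λ u → lin (λ v → coeff (starW u v) w) B) A
coeff-⋆ A B w = trans (coeff≡lin-δ (A ⋆ B) w) (trans (lin-concatMap (δ w) _ A) (∑-cong summand A))
  where
  summand : (a : ℚ × Word) →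
    lin (δ w) (concatMap (λ b → scale (proj₁ a * proj₁ b) (starW (proj₂ a) (proj₂ b))) B) ≡ proj₁ a * lin (λ v → coeff (starW (proj₂ a) v) w) B
  summand (c , u) = begin
    lin (δ w) (concatMap (λ b → scale (c * proj₁ b) (starW u (proj₂ b))) B)  ≡⟨ lin-concatMap (δ w) _ B ⟩
    ∑ (λ b → lin (δ w) (scale (c * proj₁ b) (starW u (proj₂ b)))) B           ≡⟨ ∑-cong term B ⟩
    ∑ (λ b → c * (proj₁ b * coeff (starW u (proj₂ b)) w)) B                  ≡⟨ ∑-*ˡ c _ B ⟩
    c * lin (λ v → coeff (starW u v) w) B ∎
    where
    term : (b : ℚ × Word) → lin (δ w) (scale (c * proj₁ b) (starW u (proj₂ b))) ≡ c * (proj₁ b * coeff (starW u (proj₂ b)) w)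
    term (d , v) = begin
      lin (δ w) (scale (c * d) (starW u v)) ≡⟨ lin-scale (δ w) (c * d) (starW u v) ⟩
      (c * d) * lin (δ w) (starW u v)       ≡⟨ QP.*-assoc c d _ ⟩
      c * (d * lin (δ w) (starW u v))       ≡⟨ cong (λ z → c * (d * z)) (coeff≡lin-δ (starW u v) w) ⟨
      c * (d * coeff (starW u v) w) ∎

if-+-* : (b : Bool) (c X Fv : ℚ) → (if b then c + X else X) * Fv ≡ (if b then c * Fv else 0ℚ) + X * Fv
if-+-* true c X Fv = QP.*-distribʳ-+ Fv c X
if-+-* false c X Fv = sym (QP.+-identityˡ (X * Fv))

lin≡∑-coeff : (F : Word → ℚ) (A : Alg) (S : List Word) → Unique S → (∀ {t} → t ∈ A → proj₂ t ∈ S) →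
  lin F A ≡ ∑ (λ v → coeff A v * F v) S
lin≡∑-coeff F [] S u h = sym (∑-zero (λ v → QP.*-zeroˡ (F v)) S)
lin≡∑-coeff F ((c , x) ∷ A) S u h = begin
  c * F x + lin F A ≡⟨ cong₂ _+_ (sym (∑-select-∈ _≟W_ (λ v → c * F v) x S u (h (here refl)))) (lin≡∑-coeff F A S u (λ m → h (there m))) ⟩
  ∑ (λ v → if does (x ≟W v) then c * F v else 0ℚ) S + ∑ (λ v → coeff A v * F v) S
    ≡⟨ sym (∑-+ _ _ S) ⟩
  ∑ (λ v → (if does (x ≟W v) then c * F v else 0ℚ) + coeff A v * F v) S
    ≡⟨ ∑-cong (λ v → sym (if-+-* (does (x ≟W v)) c (coeff A v) (F v))) S ⟩
  ∑ (λ v → coeff ((c , x) ∷ A) v * F v) S ∎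

-- Evaluate both sides on the deduplicated support of A ++ B.
lin-resp-≈ : (F : Word → ℚ) {A B : Alg} → A ≈A B → lin F A ≡ lin F B
lin-resp-≈ F {A} {B} e = begin
  lin F A                         ≡⟨ lin≡∑-coeff F A S (deduplicate-! L) (λ m → ∈-deduplicate⁺ _≟W_ (∈-map⁺ proj₂ (∈-++⁺ˡ m))) ⟩
  ∑ (λ v → coeff A v * F v) S ≡⟨ ∑-cong (λ v → cong (_* F v) (e v)) S ⟩
  ∑ (λ v → coeff B v * F v) S ≡⟨ lin≡∑-coeff F B S (deduplicate-! L) (λ m → ∈-deduplicate⁺ _≟W_ (∈-map⁺ proj₂ (∈-++⁺ʳ A m))) ⟨
  lin F B ∎
  where
  L = map proj₂ (A ++ B)
  S = deduplicate _≟W_ L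

lin-∑ : {A : Set} (h : A → Word → ℚ) (L : List A) (B : Alg) → lin (λ u → ∑ (λ x → h x u) L) B ≡ ∑ (λ x → lin (h x) B) L
lin-∑ h L B = trans (∑-cong (λ t → sym (∑-*ˡ (proj₁ t) (λ x → h x (proj₂ t)) L)) B) (∑-swap (λ t x → proj₁ t * h x (proj₂ t)) B L)

lin-* : (k : ℚ) (G : Word → ℚ) (B : Alg) → lin (λ u → k * G u) B ≡ k * lin G B
lin-* k G B = trans (∑-cong (λ t → trans (sym (QP.*-assoc (proj₁ t) k (G (proj₂ t)))) (trans (cong (_* G (proj₂ t)) (QP.*-comm (proj₁ t) k)) (QP.*-assoc k (proj₁ t) (G (proj₂ t))))) B) (∑-*ˡ k _ B)

lin-cong : {G G' : Word → ℚ} → (∀ u → G u ≡ G' u) → (B : Alg) → lin G B ≡ lin G' B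
lin-cong e B = ∑-cong (λ t → cong (proj₁ t *_) (e (proj₂ t))) B

onJust : Maybe ℕ → (ℕ → ℚ) → ℚ
onJust nothing f = 0ℚ
onJust (just d) f = f d

lin-onJust : (m : Maybe ℕ) (f : ℕ → Word → ℚ) (B : Alg) → lin (λ u → onJust m (λ d → f d u)) B ≡ onJust m (λ d → lin (f d) B)
lin-onJust nothing f B = ∑-zero (λ t → QP.*-zeroʳ (proj₁ t)) B
lin-onJust (just d) f B = refl

onJust-* : (m : Maybe ℕ) (k : ℚ) (f : ℕ → ℚ) → k * onJust m f ≡ onJust m (λ d → k * f d)
onJust-* nothing k f = QP.*-zeroʳ k
onJust-* (just d) k f = refl

onJust-cong : (m : Maybe ℕ) {f g : ℕ → ℚ} → (∀ d → m ≡ just d → f d ≡ g d) → onJust m f ≡ onJust m g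
onJust-cong nothing h = refl
onJust-cong (just d) h = h d refl

coeff-scale : (c : ℚ) (A : Alg) (w : Word) → coeff (scale c A) w ≡ c * coeff A w
coeff-scale c A w = trans (coeff≡lin-δ (scale c A) w) (trans (lin-scale (δ w) c A) (cong (c *_) (sym (coeff≡lin-δ A w))))

coeff-concatMap : {A : Set} (f : A → Alg) (L : List A) (w : Word) → coeff (concatMap f L) w ≡ ∑ (λ x → coeff (f x) w) L
coeff-concatMap f L w = trans (coeff≡lin-δ (concatMap f L) w) (trans (lin-concatMap (δ w) f L) (∑-cong (λ x → sym (coeff≡lin-δ (f x) w)) L))

coeff-scale-concatMap : {A : Set} (c : ℚ) (f : A → Alg) (L : List A) (w : Word) →
  coeff (scale c (concatMap f L)) w ≡ c * ∑ (λ x → coeff (f x) w) L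
coeff-scale-concatMap c f L w = trans (coeff-scale c (concatMap f L) w) (cong (c *_) (coeff-concatMap f L w))

∑δ-∉ : (w : Word) (L : List Word) → w ∉ L → ∑ (δ w) L ≡ 0ℚ
∑δ-∉ w [] n = refl
∑δ-∉ w (y ∷ L) n with y ≟W w
... | yes refl = ⊥-elim (n (here refl))
... | no _ = trans (QP.+-identityˡ _) (∑δ-∉ w L (λ m → n (there m)))

∑δ-∈ : (w : Word) (L : List Word) → Unique L → w ∈ L → ∑ (δ w) L ≡ 1ℚ
∑δ-∈ w (x ∷ L) u (here refl) with x ≟W x
... | yes _ = trans (cong (1ℚ +_) (∑δ-∉ x L (unique-head u))) (QP.+-identityʳ 1ℚ)
... | no ne = ⊥-elim (ne refl)
∑δ-∈ w (x ∷ L) u (there m) with x ≟W w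
... | yes refl = ⊥-elim (unique-head u m)
... | no _ = trans (QP.+-identityˡ _) (∑δ-∈ w L (unique-tail u) m)

∑δ-same-elements : (L1 L2 : List Word) → Unique L1 → Unique L2 → (∀ {x} → x ∈ L1 → x ∈ L2) → (∀ {x} → x ∈ L2 → x ∈ L1) → ∀ w → ∑ (δ w) L1 ≡ ∑ (δ w) L2
∑δ-same-elements L1 L2 u1 u2 s12 s21 w with w ∈W? L1
... | yes m = trans (∑δ-∈ w L1 u1 m) (sym (∑δ-∈ w L2 u2 (s12 m)))
... | no nm = trans (∑δ-∉ w L1 nm) (sym (∑δ-∉ w L2 (λ m → nm (s21 m))))

T→≡ : ∀ {b} → T b → b ≡ true
T→≡ {true} _ = refl

¬T→≡ : ∀ {b} → ¬ T b → b ≡ false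
¬T→≡ {true} n = ⊥-elim (n tt)
¬T→≡ {false} _ = refl

<⇒<ᵇ≡true : ∀ {m n} → m < n → (m <ᵇ n) ≡ true
<⇒<ᵇ≡true l = T→≡ (NP.<⇒<ᵇ l)

≮⇒<ᵇ≡false : ∀ {m n} → ¬ (m < n) → (m <ᵇ n) ≡ false
≮⇒<ᵇ≡false {m} {n} nl = ¬T→≡ (λ t → nl (NP.<ᵇ⇒< m n t))

≤⇒≤ᵇ≡true : ∀ {m n} → m ≤ n → (m ≤ᵇ n) ≡ true
≤⇒≤ᵇ≡true l = T→≡ (NP.≤⇒≤ᵇ l)

≰⇒≤ᵇ≡false : ∀ {m n} → ¬ (m ≤ n) → (m ≤ᵇ n) ≡ false
≰⇒≤ᵇ≡false {m} {n} nl = ¬T→≡ (λ t → nl (NP.≤ᵇ⇒≤ m n t))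

≟C-refl : ∀ e → does (e ≟C e) ≡ true
≟C-refl plus = refl
≟C-refl minus = refl

≟C-≢ : ∀ {e h} → e ≢ h → does (e ≟C h) ≡ false
≟C-≢ {plus} {plus} ne = ⊥-elim (ne refl)
≟C-≢ {plus} {minus} ne = refl
≟C-≢ {minus} {plus} ne = refl
≟C-≢ {minus} {minus} ne = ⊥-elim (ne refl)

≟C-sound : ∀ {e h} → does (e ≟C h) ≡ true → e ≡ h
≟C-sound {plus} {plus} _ = refl
≟C-sound {minus} {minus} _ = refl
≟C-sound {plus} {minus} ()
≟C-sound {minus} {plus} ()

compsAux-sound : {L : Set} (ls : List L) (fuel m : ℕ) {q : Comp L} → q ∈ compsAux ls fuel m → IsComp m q
compsAux-sound ls fuel zero (here refl) = All.[] , refl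
compsAux-sound ls (suc fuel) (suc m) {q} mem with ∈-concatMap⁻′ (upTo (suc m)) mem
... | a , ma , m2 with ∈-concatMap⁻′ ls m2
... | e , me , m3 with ∈-map⁻ (λ rest → (suc a , e) ∷ rest) m3
... | rest , mr , refl with compsAux-sound ls fuel (m ∸ a) mr
... | al , s = (s≤s z≤n All.∷ al) , cong suc (trans (cong (a ℕ.+_) s) (NP.m+[n∸m]≡n (NP.≤-pred (∈-upTo⁻ ma))))

∈-allC2 : (e : C2) → e ∈ allC2
∈-allC2 plus = here refl
∈-allC2 minus = there (here refl)

compsAux-complete : (fuel m : ℕ) (q : Comp C2) → IsComp m q → m ≤ fuel → q ∈ compsAux allC2 fuel m
compsAux-complete fuel zero [] ic le = here refl
compsAux-complete fuel (suc m) [] (_ , ()) le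
compsAux-complete fuel m ((zero , e) ∷ q) (() All.∷ _ , _) le
compsAux-complete zero zero ((suc a , e) ∷ q) (_ , ()) le
compsAux-complete zero (suc m) ((suc a , e) ∷ q) ic ()
compsAux-complete (suc fuel) zero ((suc a , e) ∷ q) (_ , ()) le
compsAux-complete (suc fuel) (suc m) ((suc a , e) ∷ q) (_ All.∷ al , s) (s≤s le) =
  ∈-concatMap⁺′ {f = parts} (∈-upTo⁺ (s≤s a≤m)) (∈-concatMap⁺′ {f = labelled a} (∈-allC2 e)
    (∈-map⁺ ((suc a , e) ∷_) (compsAux-complete fuel (m ∸ a) q (al , s') (NP.≤-trans (NP.m∸n≤m m a) le))))
  where
  labelled : ℕ → C2 → List (Comp C2)
  labelled a e = map ((suc a , e) ∷_) (compsAux allC2 fuel (m ∸ a))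
  parts : ℕ → List (Comp C2)
  parts a = concatMap (labelled a) allC2
  s0 : a ℕ.+ sum (map proj₁ q) ≡ m
  s0 = NP.suc-injective s
  a≤m : a ≤ m
  a≤m = subst (a ≤_) s0 (NP.m≤m+n a _)
  s' : sum (map proj₁ q) ≡ m ∸ a
  s' = sym (trans (cong (_∸ a) (sym s0)) (NP.m+n∸m≡n a _))

allC2-unique : Unique allC2
allC2-unique = ((λ ()) All.∷ All.[]) ∷ All.[] ∷ []

compsAux-unique : (fuel m : ℕ) → Unique (compsAux allC2 fuel m)
compsAux-unique fuel zero = All.[] ∷ []
compsAux-unique zero (suc m) = []
compsAux-unique (suc fuel) (suc m) = unique-concatMap parts (UniqueP.upTo⁺ (suc m))
  (λ {a} _ → unique-concatMap (labelled a) allC2-unique (λ {e} _ → UniqueP.map⁺ (λ { refl → refl }) (compsAux-unique fuel (m ∸ a)))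
     (λ {e} {e'} _ _ z1 z2 → let (_ , _ , e1) = ∈-map⁻ ((suc a , e) ∷_) z1 ; (_ , _ , e2) = ∈-map⁻ ((suc a , e') ∷_) z2 in cong proj₂ (LP.∷-injectiveˡ (trans (sym e1) e2))))
  (λ {a} {b} _ _ z1 z2 → let (e , _ , w1) = ∈-concatMap⁻′ {f = labelled a} allC2 z1 ; (e' , _ , w2) = ∈-concatMap⁻′ {f = labelled b} allC2 z2
                             (_ , _ , e1) = ∈-map⁻ ((suc a , e) ∷_) w1 ; (_ , _ , e2) = ∈-map⁻ ((suc b , e') ∷_) w2 in NP.suc-injective (cong proj₁ (LP.∷-injectiveˡ (trans (sym e1) e2))))
  where
  labelled : ℕ → C2 → List (Comp C2)
  labelled a e = map ((suc a , e) ∷_) (compsAux allC2 fuel (m ∸ a))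
  parts : ℕ → List (Comp C2)
  parts a = concatMap (labelled a) allC2

compsAux-fuel : {L : Set} (ls : List L) (f f' m : ℕ) → m ≤ f → m ≤ f' → compsAux ls f m ≡ compsAux ls f' m
compsAux-fuel ls f f' zero _ _ = refl
compsAux-fuel ls (suc f) (suc f') (suc m) (s≤s le) (s≤s le') =
  cong concat (LP.map-cong (λ a → cong concat (LP.map-cong (λ e → cong (map _) (compsAux-fuel ls f f' (m ∸ a) (NP.≤-trans (NP.m∸n≤m m a) le) (NP.≤-trans (NP.m∸n≤m m a) le'))) ls)) (upTo (suc m)))

∑-Γ-suc : (M : ℕ) (F : Comp C2 → ℚ) → ∑ F (Γ allC2 (suc M)) ≡ ∑ (λ b → ∑ (λ h → ∑ (λ r → F ((suc b , h) ∷ r)) (Γ allC2 (M ∸ b))) allC2) (upTo (suc M))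
∑-Γ-suc M F = trans (∑-concatMap F gb (upTo (suc M))) (∑-cong (λ b → trans (∑-concatMap F (gh b) allC2)
  (∑-cong (λ h → trans (∑-map F ((suc b , h) ∷_) (compsAux allC2 M (M ∸ b))) (cong (∑ (λ r → F ((suc b , h) ∷ r))) (compsAux-fuel allC2 M (M ∸ b) (M ∸ b) (NP.m∸n≤m M b) NP.≤-refl))) allC2)) (upTo (suc M)))
  where
  gh : ℕ → C2 → List (Comp C2)
  gh b h = map ((suc b , h) ∷_) (compsAux allC2 M (M ∸ b))
  gb : ℕ → List (Comp C2)
  gb b = concatMap (gh b) allC2

inserts-↭ : (x : ℕ) (τ : List ℕ) {σ : List ℕ} → σ ∈ inserts x τ → σ ↭ x ∷ τ
inserts-↭ x [] (here refl) = ↭-refl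
inserts-↭ x (y ∷ ys) (here refl) = ↭-refl
inserts-↭ x (y ∷ ys) (there m) with ∈-map⁻ (y ∷_) m
... | σ' , m' , refl = ↭-trans (prep y (inserts-↭ x ys m')) (swap y x ↭-refl)

∈-inserts : (x : ℕ) (a b : List ℕ) → a ++ x ∷ b ∈ inserts x (a ++ b)
∈-inserts x [] [] = here refl
∈-inserts x [] (y ∷ b) = here refl
∈-inserts x (y ∷ a) b = there (∈-map⁺ (y ∷_) (∈-inserts x a b))

length-inserts : (x : ℕ) (τ : List ℕ) → length (inserts x τ) ≡ suc (length τ)
length-inserts x [] = refl
length-inserts x (y ∷ ys) = cong suc (trans (LP.length-map (y ∷_) (inserts x ys)) (length-inserts x ys))

inserts-unique : (x : ℕ) (τ : List ℕ) → x ∉ τ → Unique (inserts x τ)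
inserts-unique x [] n = All.[] ∷ []
inserts-unique x (y ∷ ys) n = ∉⇒unique-∷ nm (UniqueP.map⁺ (λ { refl → refl }) (inserts-unique x ys (λ m → n (there m))))
  where
  nm : (x ∷ y ∷ ys) ∉ map (y ∷_) (inserts x ys)
  nm m with ∈-map⁻ (y ∷_) m
  ... | _ , _ , refl = n (here refl)

remove : ℕ → List ℕ → List ℕ
remove x [] = []
remove x (y ∷ ys) = if does (x ℕ.≟ y) then ys else y ∷ remove x ys

≡ᵇ-refl : ∀ x → (x ℕ.≡ᵇ x) ≡ true
≡ᵇ-refl zero = refl
≡ᵇ-refl (suc x) = ≡ᵇ-refl x

≢⇒≡ᵇ-false : ∀ {x y} → x ≢ y → (x ℕ.≡ᵇ y) ≡ false
≢⇒≡ᵇ-false {zero} {zero} ne = ⊥-elim (ne refl)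
≢⇒≡ᵇ-false {zero} {suc y} ne = refl
≢⇒≡ᵇ-false {suc x} {zero} ne = refl
≢⇒≡ᵇ-false {suc x} {suc y} ne = ≢⇒≡ᵇ-false {x} {y} (λ e → ne (cong suc e))

remove-inserts : (x : ℕ) (τ : List ℕ) {σ : List ℕ} → x ∉ τ → σ ∈ inserts x τ → remove x σ ≡ τ
remove-inserts x [] n (here refl) rewrite ≡ᵇ-refl x = refl
remove-inserts x (y ∷ ys) n (here refl) rewrite ≡ᵇ-refl x = refl
remove-inserts x (y ∷ ys) n (there m) with ∈-map⁻ (y ∷_) m
... | σ' , m' , refl rewrite ≢⇒≡ᵇ-false {x} {y} (λ e → n (here e)) = cong (y ∷_) (remove-inserts x ys (λ m → n (there m)) m')

perms-↭ : (l : List ℕ) {σ : List ℕ} → σ ∈ perms l → σ ↭ l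
perms-↭ [] (here refl) = ↭-refl
perms-↭ (x ∷ xs) m with ∈-concatMap⁻′ {f = inserts x} (perms xs) m
... | τ , mτ , mσ = ↭-trans (inserts-↭ x τ mσ) (prep x (perms-↭ xs mτ))

∈-perms : (l : List ℕ) {σ : List ℕ} → σ ↭ l → σ ∈ perms l
∈-perms [] p with PermP.↭-empty-inv p
... | refl = here refl
∈-perms (x ∷ xs) {σ} p with ∈-∃++ (PermP.∈-resp-↭ (↭-sym p) (here refl))
... | a , b , refl = ∈-concatMap⁺′ {f = inserts x} (∈-perms xs (PermP.drop-mid a [] (↭-trans p (↭-refl {x = x ∷ xs})))) (∈-inserts x a b)

perms-unique : (l : List ℕ) → Unique l → Unique (perms l)
perms-unique [] _ = All.[] ∷ []
perms-unique (x ∷ xs) u = unique-concatMap (inserts x) (perms-unique xs (unique-tail u))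
  (λ {τ} mτ → inserts-unique x τ (x∉ mτ))
  (λ {τ} {τ'} mτ mτ' z1 z2 → trans (sym (remove-inserts x τ (x∉ mτ) z1)) (remove-inserts x τ' (x∉ mτ') z2))
  where
  x∉ : ∀ {τ} → τ ∈ perms xs → x ∉ τ
  x∉ mτ m = unique-head u (PermP.∈-resp-↭ (perms-↭ xs mτ) m)

length-concatMap-const : {A B : Set} (f : A → List B) (k : ℕ) (L : List A) → (∀ {x} → x ∈ L → length (f x) ≡ k) →
  length (concatMap f L) ≡ length L ℕ.* k
length-concatMap-const f k [] h = refl
length-concatMap-const f k (x ∷ L) h = trans (LP.length-++ (f x)) (cong₂ ℕ._+_ (h (here refl)) (length-concatMap-const f k L (λ m → h (there m))))

length-perms : (l : List ℕ) → length (perms l) ≡ length l !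
length-perms [] = refl
length-perms (x ∷ xs) = trans (length-concatMap-const (inserts x) (suc (length xs)) (perms xs)
    (λ {τ} m → trans (length-inserts x τ) (cong suc (PermP.↭-length (perms-↭ xs m)))))
  (trans (cong (ℕ._* suc (length xs)) (length-perms xs)) (NP.*-comm (length xs !) (suc (length xs))))

∈-signVecs : (g : List C2) → g ∈ signVecs (length g)
∈-signVecs [] = here refl
∈-signVecs (e ∷ g) = ∈-concatMap⁺′ {f = λ h → map (h ∷_) (signVecs (length g))} (∈-allC2 e) (∈-map⁺ (e ∷_) (∈-signVecs g))

signVecs-length : (n : ℕ) {g : List C2} → g ∈ signVecs n → length g ≡ n
signVecs-length zero (here refl) = refl
signVecs-length (suc n) m with ∈-concatMap⁻′ {f = λ h → map (h ∷_) (signVecs n)} allC2 m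
... | h , _ , m' with ∈-map⁻ (h ∷_) m'
... | g , mg , refl = cong suc (signVecs-length n mg)

signVecs-unique : (n : ℕ) → Unique (signVecs n)
signVecs-unique zero = All.[] ∷ []
signVecs-unique (suc n) = unique-concatMap (λ h → map (h ∷_) (signVecs n)) allC2-unique
  (λ {h} _ → UniqueP.map⁺ (λ { refl → refl }) (signVecs-unique n))
  (λ {h} {h'} _ _ z1 z2 → let (_ , _ , e1) = ∈-map⁻ (h ∷_) z1 ; (_ , _ , e2) = ∈-map⁻ (h' ∷_) z2 in LP.∷-injectiveˡ (trans (sym e1) e2))

length-signVecs : (n : ℕ) → length (signVecs n) ≡ 2 ^ n
length-signVecs zero = refl
length-signVecs (suc n) = length-concatMap-const (λ h → map (h ∷_) (signVecs n)) (2 ^ n) allC2 (λ _ → trans (LP.length-map _ (signVecs n)) (length-signVecs n))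

vals : Word → List ℕ
vals w = map proj₁ w

range : ℕ → List ℕ
range n = map suc (upTo n)

zip-vals : (σ : List ℕ) (g : List C2) → length σ ≡ length g → vals (zip σ g) ≡ σ
zip-vals [] g e = refl
zip-vals (x ∷ σ) [] ()
zip-vals (x ∷ σ) (h ∷ g) e = cong (x ∷_) (zip-vals σ g (NP.suc-injective e))

zip-signs : (σ : List ℕ) (g : List C2) → length σ ≡ length g → map proj₂ (zip σ g) ≡ g
zip-signs [] [] e = refl
zip-signs [] (h ∷ g) ()
zip-signs (x ∷ σ) [] ()
zip-signs (x ∷ σ) (h ∷ g) e = cong (h ∷_) (zip-signs σ g (NP.suc-injective e))

zip-eta : (w : Word) → zip (vals w) (map proj₂ w) ≡ w
zip-eta [] = refl
zip-eta ((x , h) ∷ w) = cong ((x , h) ∷_) (zip-eta w)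

length-range : (n : ℕ) → length (range n) ≡ n
length-range n = trans (LP.length-map suc (upTo n)) (LP.length-upTo n)

elems-↭ : (n : ℕ) {w : Word} → w ∈ elems n → vals w ↭ range n
elems-↭ n {w} m with ∈-concatMap⁻′ {f = λ σ → map (zip σ) (signVecs n)} (perms (range n)) m
... | σ , mσ , m' with ∈-map⁻ (zip σ) m'
... | g , mg , refl = subst (_↭ range n) (sym (zip-vals σ g (trans (trans (PermP.↭-length (perms-↭ (range n) mσ)) (length-range n)) (sym (signVecs-length n mg))))) (perms-↭ (range n) mσ)

elems-length : (n : ℕ) {w : Word} → w ∈ elems n → length w ≡ n
elems-length n {w} m = trans (sym (LP.length-map proj₁ w)) (trans (PermP.↭-length (elems-↭ n m)) (length-range n))

∈-elems : (n : ℕ) (w : Word) → vals w ↭ range n → w ∈ elems n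
∈-elems n w p = subst (_∈ elems n) (zip-eta w)
  (∈-concatMap⁺′ {f = λ σ → map (zip σ) (signVecs n)} (∈-perms (range n) p)
    (∈-map⁺ (zip (vals w)) (subst (λ k → map proj₂ w ∈ signVecs k) lw (∈-signVecs (map proj₂ w)))))
  where
  lw : length (map proj₂ w) ≡ n
  lw = trans (LP.length-map proj₂ w) (trans (sym (LP.length-map proj₁ w)) (trans (PermP.↭-length p) (length-range n)))

range-unique : (n : ℕ) → Unique (range n)
range-unique n = UniqueP.map⁺ NP.suc-injective (UniqueP.upTo⁺ n)

elems-unique : (n : ℕ) → Unique (elems n)
elems-unique n = unique-concatMap (λ σ → map (zip σ) (signVecs n)) (perms-unique (range n) (range-unique n))
  (λ {σ} mσ → unique-map-∈ (zip σ) (λ {g} {g'} mg mg' e → trans (sym (zip-signs σ g (ls' mσ mg))) (trans (cong (map proj₂) e) (zip-signs σ g' (ls' mσ mg')))) (signVecs-unique n))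
  (λ {σ} {σ'} mσ mσ' z1 z2 → let (g , mg , e1) = ∈-map⁻ (zip σ) z1 ; (g' , mg' , e2) = ∈-map⁻ (zip σ') z2
     in trans (sym (zip-vals σ g (ls' mσ mg))) (trans (cong vals (trans (sym e1) e2)) (zip-vals σ' g' (ls' mσ' mg'))))
  where
  ls' : ∀ {σ g} → σ ∈ perms (range n) → g ∈ signVecs n → length σ ≡ length g
  ls' mσ mg = trans (trans (PermP.↭-length (perms-↭ (range n) mσ)) (length-range n)) (sym (signVecs-length n mg))

length-elems : (n : ℕ) → length (elems n) ≡ n ! ℕ.* 2 ^ n
length-elems n = trans (length-concatMap-const (λ σ → map (zip σ) (signVecs n)) (2 ^ n) (perms (range n)) (λ _ → trans (LP.length-map _ (signVecs n)) (length-signVecs n)))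
  (cong (ℕ._* 2 ^ n) (trans (length-perms (range n)) (cong _! (length-range n))))

∈-range⁻ : {n y : ℕ} → y ∈ range n → ∃ λ j → (y ≡ suc j) × (j < n)
∈-range⁻ m with ∈-map⁻ suc m
... | j , mj , refl = j , refl , ∈-upTo⁻ mj

Increasing : List ℕ → Set
Increasing = AllPairs _<_

increasing-↭⇒≡ : (xs ys : List ℕ) → Increasing xs → Increasing ys → xs ↭ ys → xs ≡ ys
increasing-↭⇒≡ [] ys _ _ p = sym (PermP.↭-empty-inv (↭-sym p))
increasing-↭⇒≡ (x ∷ xs) [] _ _ p with PermP.↭-length p
... | ()
increasing-↭⇒≡ (x ∷ xs) (y ∷ ys) (ax ∷ ix) (ay ∷ iy) p with x ℕ.≟ y
... | yes refl = cong (x ∷_) (increasing-↭⇒≡ xs ys ix iy (PermP.drop-∷ p))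
... | no ne with PermP.∈-resp-↭ p (here refl) | PermP.∈-resp-↭ (↭-sym p) (here refl)
... | here e | _ = ⊥-elim (ne e)
... | there _ | here e = ⊥-elim (ne (sym e))
... | there m1 | there m2 = ⊥-elim (NP.<-asym (All.lookup ay m1) (All.lookup ax m2))

at-monotone : (P : List ℕ) → Increasing P → {i j : ℕ} → i < j → j < length P → at P (suc i) < at P (suc j)
at-monotone (x ∷ P) (ax ∷ ip) {zero} {suc j} (s≤s z≤n) (s≤s jl) = All.lookup ax (at∈ P j jl)
  where
  at∈ : (P : List ℕ) (j : ℕ) → j < length P → at P (suc j) ∈ P
  at∈ (y ∷ P) zero _ = here refl
  at∈ (y ∷ P) (suc j) (s≤s l) = there (at∈ P j l)
at-monotone (x ∷ P) (ax ∷ ip) {suc i} {suc j} (s≤s ij) (s≤s jl) = at-monotone P ip ij jl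

at-injective : (P : List ℕ) → Increasing P → {i j : ℕ} → i < length P → j < length P → at P (suc i) ≡ at P (suc j) → i ≡ j
at-injective P ip {i} {j} il jl e with NP.<-cmp i j
... | tri< a _ _ = ⊥-elim (NP.<-irrefl e (at-monotone P ip a jl))
... | tri≈ _ b _ = b
... | tri> _ _ c = ⊥-elim (NP.<-irrefl (sym e) (at-monotone P ip c il))

rangeFrom : ℕ → ℕ → List ℕ
rangeFrom i zero = []
rangeFrom i (suc k) = i ∷ rangeFrom (suc i) k

applyUpTo-rangeFrom : (f : ℕ → ℕ) (i k : ℕ) → (∀ j → f j ≡ i ℕ.+ j) → applyUpTo f k ≡ rangeFrom i k
applyUpTo-rangeFrom f i zero h = refl
applyUpTo-rangeFrom f i (suc k) h = cong₂ _∷_ (trans (h 0) (NP.+-identityʳ i)) (applyUpTo-rangeFrom (λ j → f (suc j)) (suc i) k (λ j → trans (h (suc j)) (NP.+-suc i j)))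

range≡rangeFrom : (n : ℕ) → range n ≡ rangeFrom 1 n
range≡rangeFrom n = trans (LP.map-upTo suc n) (applyUpTo-rangeFrom suc 1 n (λ j → refl))

map-at-rangeFrom : (x : ℕ) (xs : List ℕ) (i k : ℕ) → map (at (x ∷ xs)) (rangeFrom (suc (suc i)) k) ≡ map (at xs) (rangeFrom (suc i) k)
map-at-rangeFrom x xs i zero = refl
map-at-rangeFrom x xs i (suc k) = cong (at xs (suc i) ∷_) (map-at-rangeFrom x xs (suc i) k)

map-at-range : (P : List ℕ) → map (at P) (range (length P)) ≡ P
map-at-range P = trans (cong (map (at P)) (range≡rangeFrom (length P))) (go P)
  where
  go : (P : List ℕ) → map (at P) (rangeFrom 1 (length P)) ≡ P
  go [] = refl
  go (x ∷ xs) = cong (x ∷_) (trans (map-at-rangeFrom x xs 0 (length xs)) (go xs))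

at-++ˡ : (P Q : List ℕ) {j : ℕ} → j < length P → at (P ++ Q) (suc j) ≡ at P (suc j)
at-++ˡ (x ∷ P) Q {zero} _ = refl
at-++ˡ (x ∷ P) Q {suc j} (s≤s l) = at-++ˡ P Q l

at-++ʳ : (P Q : List ℕ) (j : ℕ) → at (P ++ Q) (length P ℕ.+ suc j) ≡ at Q (suc j)
at-++ʳ [] Q j = refl
at-++ʳ (x ∷ []) Q j = refl
at-++ʳ (x ∷ y ∷ P) Q j = at-++ʳ (y ∷ P) Q j

positions-≥ : (x : Bool) (i : ℕ) (b : List Bool) → All (i ≤_) (positions x i b)
positions-≥ x i [] = All.[]
positions-≥ true i (true ∷ b) = NP.≤-refl All.∷ All.map (λ p → NP.≤-trans (NP.n≤1+n i) p) (positions-≥ true (suc i) b)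
positions-≥ true i (false ∷ b) = All.map (λ p → NP.≤-trans (NP.n≤1+n i) p) (positions-≥ true (suc i) b)
positions-≥ false i (true ∷ b) = All.map (λ p → NP.≤-trans (NP.n≤1+n i) p) (positions-≥ false (suc i) b)
positions-≥ false i (false ∷ b) = NP.≤-refl All.∷ All.map (λ p → NP.≤-trans (NP.n≤1+n i) p) (positions-≥ false (suc i) b)

positions-increasing : (x : Bool) (i : ℕ) (b : List Bool) → Increasing (positions x i b)
positions-increasing x i [] = []
positions-increasing true i (true ∷ b) = positions-≥ true (suc i) b ∷ positions-increasing true (suc i) b
positions-increasing true i (false ∷ b) = positions-increasing true (suc i) b
positions-increasing false i (true ∷ b) = positions-increasing false (suc i) b
positions-increasing false i (false ∷ b) = positions-≥ false (suc i) b ∷ positions-increasing false (suc i) b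

positions-↭ : (i : ℕ) (b : List Bool) → positions true i b ++ positions false i b ↭ rangeFrom i (length b)
positions-↭ i [] = ↭-refl
positions-↭ i (true ∷ b) = prep i (positions-↭ (suc i) b)
positions-↭ i (false ∷ b) = ↭-trans (PermP.shift i (positions true (suc i) b) (positions false (suc i) b)) (prep i (positions-↭ (suc i) b))

positions-true-injective : (i : ℕ) (b b' : List Bool) → positions true i b ≡ positions true i b' → length b ≡ length b' → b ≡ b'
positions-true-injective i [] [] e l = refl
positions-true-injective i (true ∷ b) (true ∷ b') e l = cong (true ∷_) (positions-true-injective (suc i) b b' (LP.∷-injectiveʳ e) (NP.suc-injective l))
positions-true-injective i (false ∷ b) (false ∷ b') e l = cong (false ∷_) (positions-true-injective (suc i) b b' e (NP.suc-injective l))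
positions-true-injective i (true ∷ b) (false ∷ b') e l = ⊥-elim (NP.1+n≰n (All.lookup (positions-≥ true (suc i) b') (subst (i ∈_) e (here refl))))
positions-true-injective i (false ∷ b) (true ∷ b') e l = ⊥-elim (NP.1+n≰n (All.lookup (positions-≥ true (suc i) b) (subst (i ∈_) (sym e) (here refl))))

masks-lengths : (n m : ℕ) {b : List Bool} → b ∈ masks n m → (i : ℕ) →
  (length (positions true i b) ≡ n) × (length (positions false i b) ≡ m) × (length b ≡ n ℕ.+ m)
masks-lengths zero m (here refl) i = rt m i , rf m i , LP.length-replicate m
  where
  rt : ∀ m i → length (positions true i (replicate m false)) ≡ 0
  rt zero i = refl
  rt (suc m) i = rt m (suc i)
  rf : ∀ m i → length (positions false i (replicate m false)) ≡ m
  rf zero i = refl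
  rf (suc m) i = cong suc (rf m (suc i))
masks-lengths (suc n) zero (here refl) i = rt (suc n) i , rf (suc n) i , trans (LP.length-replicate (suc n)) (sym (NP.+-identityʳ (suc n)))
  where
  rt : ∀ m i → length (positions true i (replicate m true)) ≡ m
  rt zero i = refl
  rt (suc m) i = cong suc (rt m (suc i))
  rf : ∀ m i → length (positions false i (replicate m true)) ≡ 0
  rf zero i = refl
  rf (suc m) i = rf m (suc i)
masks-lengths (suc n) (suc m) mb i with ∈-++⁻ (map (true ∷_) (masks n (suc m))) mb
... | inj₁ m1 with ∈-map⁻ (true ∷_) m1
... | b' , mb' , refl = let (a , c , d) = masks-lengths n (suc m) mb' (suc i) in cong suc a , c , cong suc d
masks-lengths (suc n) (suc m) mb i | inj₂ m2 with ∈-map⁻ (false ∷_) m2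
... | b' , mb' , refl = let (a , c , d) = masks-lengths (suc n) m mb' (suc i) in a , cong suc c , cong suc (trans d (sym (NP.+-suc n m)))

masks-unique : (n m : ℕ) → Unique (masks n m)
masks-unique zero m = All.[] ∷ []
masks-unique (suc n) zero = All.[] ∷ []
masks-unique (suc n) (suc m) = UniqueP.++⁺ (UniqueP.map⁺ (λ { refl → refl }) (masks-unique n (suc m))) (UniqueP.map⁺ (λ { refl → refl }) (masks-unique (suc n) m))
  (λ (z1 , z2) → let (_ , _ , e1) = ∈-map⁻ (true ∷_) z1 ; (_ , _ , e2) = ∈-map⁻ (false ∷_) z2 in tf (trans (sym e1) e2))
  where
  tf : ∀ {xs ys : List Bool} → true ∷ xs ≡ false ∷ ys → ⊥
  tf ()

masks-count : (n m : ℕ) → length (masks n m) ℕ.* (n ! ℕ.* m !) ≡ (n ℕ.+ m) !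
masks-count zero m = trans (NP.*-identityˡ (1 ℕ.* m !)) (NP.*-identityˡ (m !))
masks-count (suc n) zero = trans (NP.+-identityʳ _) (trans (NP.*-identityʳ ((suc n) !)) (cong _! (sym (NP.+-identityʳ (suc n)))))
masks-count (suc n) (suc m) = begin
  length (masks (suc n) (suc m)) ℕ.* (suc n ! ℕ.* suc m !)
    ≡⟨ cong (ℕ._* (suc n ! ℕ.* suc m !)) (trans (LP.length-++ (map (true ∷_) (masks n (suc m)))) (cong₂ ℕ._+_ (LP.length-map _ (masks n (suc m))) (LP.length-map _ (masks (suc n) m)))) ⟩
  (A ℕ.+ B) ℕ.* ((suc n ℕ.* Xf) ℕ.* (suc m ℕ.* Yf)) ≡⟨ distribute A B Xf Yf n m ⟩
  suc n ℕ.* (A ℕ.* (Xf ℕ.* (suc m ℕ.* Yf))) ℕ.+ suc m ℕ.* (B ℕ.* ((suc n ℕ.* Xf) ℕ.* Yf))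
    ≡⟨ cong₂ (λ u v → suc n ℕ.* u ℕ.+ suc m ℕ.* v) (trans (masks-count n (suc m)) (cong _! (NP.+-suc n m))) (masks-count (suc n) m) ⟩
  suc n ℕ.* K ℕ.+ suc m ℕ.* K ≡⟨ collect n m K ⟩
  suc (suc n ℕ.+ m) ℕ.* K ≡⟨ cong _! (sym (cong suc (NP.+-suc n m))) ⟩
  (suc n ℕ.+ suc m) ! ∎
  where
  open ≡-Reasoning
  A = length (masks n (suc m))
  B = length (masks (suc n) m)
  Xf = n !
  Yf = m !
  K = (suc n ℕ.+ m) !
  distribute : ∀ A B Xf Yf n m → (A ℕ.+ B) ℕ.* ((suc n ℕ.* Xf) ℕ.* (suc m ℕ.* Yf)) ≡ suc n ℕ.* (A ℕ.* (Xf ℕ.* (suc m ℕ.* Yf))) ℕ.+ suc m ℕ.* (B ℕ.* ((suc n ℕ.* Xf) ℕ.* Yf))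
  distribute = NS.solve-∀
  collect : ∀ n m K → suc n ℕ.* K ℕ.+ suc m ℕ.* K ≡ suc (suc n ℕ.+ m) ℕ.* K
  collect = NS.solve-∀

continuesRun : ℕ → C2 → ℕ × C2 → Bool
continuesRun y e (z , h) = (y <ᵇ z) ∧ does (e ≟C h)

-- fits p w: cut into consecutive segments of lengths pᵢ, w has increasing values and constant sign equal to the
-- label εᵢ on each segment. co w ≤Γ p holds exactly when w fits p (co≤Γ≡fits).
mutual
  fits : Comp C2 → Word → Bool
  fits [] [] = true
  fits [] (_ ∷ _) = false
  fits ((zero , e) ∷ p) w = false
  fits ((suc a , e) ∷ p) [] = false
  fits ((suc a , e) ∷ p) ((y , h) ∷ w) = does (e ≟C h) ∧ fitsRun a e y w p

  fitsRun : ℕ → C2 → ℕ → Word → Comp C2 → Bool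
  fitsRun zero e y w p = fits p w
  fitsRun (suc a) e y [] p = false
  fitsRun (suc a) e y ((z , h) ∷ w) p = continuesRun y e (z , h) ∧ fitsRun a e z w p

runLength : ℕ → C2 → Word → ℕ
runLength x g [] = 0
runLength x g ((y , h) ∷ w) = if continuesRun x g (y , h) then suc (runLength y g w) else 0

coGo-eq : (x : ℕ) (g : C2) (k : ℕ) (w : Word) → coGo x g k w ≡ (k ℕ.+ runLength x g w , g) ∷ co (drop (runLength x g w) w)
coGo-eq x g k [] = cong (λ z → (z , g) ∷ []) (sym (NP.+-identityʳ k))
coGo-eq x g k ((y , h) ∷ w) with continuesRun x g (y , h)
... | true = trans (coGo-eq y g (suc k) w) (cong (λ z → (z , g) ∷ co (drop (runLength y g w) w)) (sym (NP.+-suc k (runLength y g w))))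
... | false = cong (λ z → (z , g) ∷ coGo y h 1 w) (sym (NP.+-identityʳ k))

RunEnds : C2 → ℕ → Word → Set
RunEnds g y [] = ⊤
RunEnds g y (t ∷ _) = continuesRun y g t ≡ false

IsRun : C2 → ℕ → Word → Word → Set
IsRun g y [] w2 = RunEnds g y w2
IsRun g y (t ∷ r) w2 = (continuesRun y g t ≡ true) × IsRun g (proj₁ t) r w2

runLength-IsRun : (x : ℕ) (g : C2) (w : Word) → IsRun g x (take (runLength x g w) w) (drop (runLength x g w) w)
runLength-IsRun x g [] = tt
runLength-IsRun x g ((y , h) ∷ w) with continuesRun x g (y , h) in eq
... | true = eq , runLength-IsRun y g w
... | false = eq

runLength-≤ : (x : ℕ) (g : C2) (w : Word) → runLength x g w ≤ length w
runLength-≤ x g [] = z≤n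
runLength-≤ x g ((y , h) ∷ w) with continuesRun x g (y , h)
... | true = s≤s (runLength-≤ y g w)
... | false = z≤n

fitsRun-inside : (e : C2) (y : ℕ) (r w2 : Word) (p : Comp C2) (k : ℕ) → IsRun e y r w2 → k ≤ length r → fitsRun k e y (r ++ w2) p ≡ fits p (drop k r ++ w2)
fitsRun-inside e y r w2 p zero rb l = refl
fitsRun-inside e y (t ∷ r) w2 p (suc k) (st , rb) (s≤s l) rewrite st = fitsRun-inside e (proj₁ t) r w2 p k rb l

fitsRun-overflow : (e : C2) (y : ℕ) (r w2 : Word) (p : Comp C2) (k : ℕ) → IsRun e y r w2 → length r < k → fitsRun k e y (r ++ w2) p ≡ false
fitsRun-overflow e y [] [] p (suc k) rb l = refl
fitsRun-overflow e y [] (t ∷ w2) p (suc k) rb l rewrite rb = refl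
fitsRun-overflow e y (t ∷ r) w2 p (suc k) (st , rb) (s≤s l) rewrite st = fitsRun-overflow e (proj₁ t) r w2 p k rb l

afterTake : {B : Set} → B → Maybe (ℕ × Comp C2) → (ℕ → Comp C2 → B) → B
afterTake z nothing f = z
afterTake z (just (d , r)) f = f d r

afterTake-cong : {B : Set} (z : B) (m : Maybe (ℕ × Comp C2)) {f g : ℕ → Comp C2 → B} →
  (∀ d r → f d r ≡ g d r) → afterTake z m f ≡ afterTake z m g
afterTake-cong z nothing h = refl
afterTake-cong z (just (d , r)) h = h d r

takeSum-label≢ : ∀ {a e b h} (q : Comp C2) → e ≢ h → takeSum a e ((b , h) ∷ q) ≡ nothing
takeSum-label≢ q ne rewrite ≟C-≢ ne = refl

takeSum-zero : ∀ {a e h} (q : Comp C2) → takeSum a e ((0 , h) ∷ q) ≡ nothing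
takeSum-zero {a} {e} {h} q with toSum (e ≟C h)
... | inj₁ refl rewrite ≟C-refl e = refl
... | inj₂ ne = takeSum-label≢ q ne

takeSum-too-big : ∀ {a e b} (q : Comp C2) → a < b → takeSum a e ((b , e) ∷ q) ≡ nothing
takeSum-too-big {a} {e} {b} q l rewrite ≟C-refl e | ≰⇒≤ᵇ≡false {b} {a} (NP.<⇒≱ l) = refl

takeSum-exact : ∀ {e} (L : ℕ) (q : Comp C2) → takeSum (suc L) e ((suc L , e) ∷ q) ≡ just (1 , q)
takeSum-exact {e} L q rewrite ≟C-refl e | ≤⇒≤ᵇ≡true {suc L} {suc L} NP.≤-refl | ≡ᵇ-refl L = refl

takeSum-partial : ∀ {a e b} (q : Comp C2) → 1 ≤ b → b < a →
  takeSum a e ((b , e) ∷ q) ≡ Maybe.map (map₁ suc) (takeSum (a ∸ b) e q)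
takeSum-partial {a} {e} {suc b} q _ l
  rewrite ≟C-refl e | ≤⇒≤ᵇ≡true {suc b} {a} (NP.<⇒≤ l) | ≢⇒≡ᵇ-false {suc b} {a} (λ eq → NP.<-irrefl eq l)
  with takeSum (a ∸ suc b) e q
... | nothing = refl
... | just _ = refl

module _ {B : Set} (z : B) where

  afterTake-label≢ : ∀ {a e b h} (q : Comp C2) (f : ℕ → Comp C2 → B) → e ≢ h → afterTake z (takeSum a e ((b , h) ∷ q)) f ≡ z
  afterTake-label≢ {a} {e} {b} {h} q f ne = cong (λ m → afterTake z m f) (takeSum-label≢ {a} {e} {b} {h} q ne)

  afterTake-zero : ∀ {a e h} (q : Comp C2) (f : ℕ → Comp C2 → B) → afterTake z (takeSum a e ((0 , h) ∷ q)) f ≡ z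
  afterTake-zero {a} {e} {h} q f = cong (λ m → afterTake z m f) (takeSum-zero {a} {e} {h} q)

  afterTake-too-big : ∀ {a e b} (q : Comp C2) (f : ℕ → Comp C2 → B) → a < b → afterTake z (takeSum a e ((b , e) ∷ q)) f ≡ z
  afterTake-too-big {a} {e} {b} q f l = cong (λ m → afterTake z m f) (takeSum-too-big {a} {e} {b} q l)

  afterTake-exact : ∀ {e} (L : ℕ) (q : Comp C2) (f : ℕ → Comp C2 → B) → afterTake z (takeSum (suc L) e ((suc L , e) ∷ q)) f ≡ f 1 q
  afterTake-exact {e} L q f = cong (λ m → afterTake z m f) (takeSum-exact {e} L q)

  afterTake-partial : ∀ {a e b} (q : Comp C2) (f : ℕ → Comp C2 → B) → 1 ≤ b → b < a →
    afterTake z (takeSum a e ((b , e) ∷ q)) f ≡ afterTake z (takeSum (a ∸ b) e q) (λ d r → f (suc d) r)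
  afterTake-partial {a} {e} {b} q f 1≤b b<a = trans (cong (λ m → afterTake z m f) (takeSum-partial {a} {e} {b} q 1≤b b<a)) (map-suc (takeSum (a ∸ b) e q))
    where
    map-suc : (m : Maybe (ℕ × Comp C2)) → afterTake z (Maybe.map (map₁ suc) m) f ≡ afterTake z m (λ d r → f (suc d) r)
    map-suc nothing = refl
    map-suc (just _) = refl

continuesRun-label : ∀ {y e z h} → continuesRun y e (z , h) ≡ true → h ≡ e
continuesRun-label {y} {e} {z} {h} s with y <ᵇ z
... | true = sym (≟C-sound s)
... | false = ⊥-elim (bf s)
  where
  bf : false ≡ true → ⊥
  bf ()

IsRun-drop : (e : C2) (y : ℕ) (r w2 : Word) (k : ℕ) → IsRun e y r w2 → k < length r →
  ∃ λ z → ∃ λ r'' → (drop k r ≡ (z , e) ∷ r'') × IsRun e z r'' w2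
IsRun-drop e y ((z , h) ∷ r) w2 zero (st , rb) l rewrite continuesRun-label {y} {e} {z} {h} st = z , r , refl , rb
IsRun-drop e y (t ∷ r) w2 (suc k) (st , rb) (s≤s l) = IsRun-drop e (proj₁ t) r w2 k rb l

mutual
  fits-run : (k : ℕ) (e : C2) (y0 : ℕ) (r1 w2 : Word) → length r1 ≤ k → IsRun e y0 r1 w2 → (p : Comp C2) →
    fits p ((y0 , e) ∷ r1 ++ w2) ≡ afterTake false (takeSum (suc (length r1)) e p) (λ _ p2 → fits p2 w2)
  fits-run k e y0 r1 w2 lk rb [] = refl
  fits-run k e y0 r1 w2 lk rb ((zero , h) ∷ p') = sym (afterTake-zero false {suc (length r1)} {e} {h} p' (λ _ p2 → fits p2 w2))
  fits-run k e y0 r1 w2 lk rb ((suc b' , h) ∷ p') with h ≟C e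
  ... | no ne rewrite takeSum-label≢ {suc (length r1)} {e} {suc b'} {h} p' (λ eq → ne (sym eq)) = refl
  ... | yes refl = fits-run-cases k e y0 r1 w2 lk rb b' p' (NP.<-cmp b' (length r1))

  fits-run-cases : (k : ℕ) (h : C2) (y0 : ℕ) (r1 w2 : Word) → length r1 ≤ k → IsRun h y0 r1 w2 → (b' : ℕ) (p' : Comp C2) →
    Tri (b' < length r1) (b' ≡ length r1) (length r1 < b') →
    fitsRun b' h y0 (r1 ++ w2) p' ≡ afterTake false (takeSum (suc (length r1)) h ((suc b' , h) ∷ p')) (λ _ p2 → fits p2 w2)
  fits-run-cases k h y0 r1 w2 lk rb b' p' (tri≈ _ refl _) = trans (fitsRun-inside h y0 r1 w2 p' (length r1) rb NP.≤-refl)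
      (trans (cong (λ z → fits p' (z ++ w2)) (LP.drop-all (length r1) r1 NP.≤-refl)) (sym (cong (λ m → afterTake false m (λ _ p2 → fits p2 w2)) (takeSum-exact {h} (length r1) p'))))
  fits-run-cases k h y0 r1 w2 lk rb b' p' (tri> _ _ c) = trans (fitsRun-overflow h y0 r1 w2 p' b' rb c) (sym (cong (λ m → afterTake false m (λ _ p2 → fits p2 w2)) (takeSum-too-big {suc (length r1)} {h} {suc b'} p' (s≤s c))))
  fits-run-cases zero h y0 [] w2 lk rb b' p' (tri< () _ _)
  fits-run-cases (suc k) h y0 r1 w2 lk rb b' p' (tri< a _ _) with IsRun-drop h y0 r1 w2 b' rb a
  ... | z , r'' , eq , rb'' = begin
    fitsRun b' h y0 (r1 ++ w2) p' ≡⟨ fitsRun-inside h y0 r1 w2 p' b' rb (NP.<⇒≤ a) ⟩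
    fits p' (drop b' r1 ++ w2) ≡⟨ cong (λ u → fits p' (u ++ w2)) eq ⟩
    fits p' ((z , h) ∷ r'' ++ w2) ≡⟨ fits-run k h z r'' w2 lr'' rb'' p' ⟩
    afterTake false (takeSum (suc (length r'')) h p') (λ _ p2 → fits p2 w2)
      ≡⟨ cong (λ u → afterTake false (takeSum u h p') (λ _ p2 → fits p2 w2)) ln ⟩
    afterTake false (takeSum (length r1 ∸ b') h p') (λ _ p2 → fits p2 w2)
      ≡⟨ sym (afterTake-partial false {suc (length r1)} {h} {suc b'} p' (λ _ p2 → fits p2 w2) (s≤s z≤n) (s≤s a)) ⟩
    afterTake false (takeSum (suc (length r1)) h ((suc b' , h) ∷ p')) (λ _ p2 → fits p2 w2) ∎
    where
    open ≡-Reasoning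
    ln : suc (length r'') ≡ length r1 ∸ b'
    ln = trans (cong length (sym eq)) (LP.length-drop b' r1)
    lr'' : length r'' ≤ k
    lr'' = NP.≤-pred (NP.≤-trans (NP.≤-reflexive ln) (NP.≤-trans (NP.m∸n≤m (length r1) b') lk))

refineDeg-cons : (a : ℕ) (e : C2) (c p : Comp C2) → is-just (refineDeg ((a , e) ∷ c) p) ≡ afterTake false (takeSum a e p) (λ _ r → is-just (refineDeg c r))
refineDeg-cons a e c p with takeSum a e p
... | nothing = refl
... | just (d , r) with refineDeg c r
...   | nothing = refl
...   | just D = refl

≤Γ≡is-just : (c p : Comp C2) → (c ≤Γ p) ≡ is-just (refineDeg c p)
≤Γ≡is-just c p with refineDeg c p
... | nothing = refl
... | just _ = refl

co-refines≡fits : (k : ℕ) (w : Word) → length w ≤ k → (p : Comp C2) → is-just (refineDeg (co w) p) ≡ fits p w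
co-refines≡fits k [] l [] = refl
co-refines≡fits k [] l ((zero , e) ∷ p) = refl
co-refines≡fits k [] l ((suc a , e) ∷ p) = refl
co-refines≡fits (suc k) ((x , g) ∷ w') (s≤s l) p = begin
  is-just (refineDeg (coGo x g 1 w') p) ≡⟨ cong (λ c → is-just (refineDeg c p)) (coGo-eq x g 1 w') ⟩
  is-just (refineDeg ((suc L , g) ∷ co (drop L w')) p) ≡⟨ refineDeg-cons (suc L) g (co (drop L w')) p ⟩
  afterTake false (takeSum (suc L) g p) (λ _ r → is-just (refineDeg (co (drop L w')) r))
    ≡⟨ afterTake-cong false (takeSum (suc L) g p) (λ _ r → co-refines≡fits k (drop L w') ld r) ⟩
  afterTake false (takeSum (suc L) g p) (λ _ r → fits r (drop L w'))
    ≡⟨ cong (λ u → afterTake false (takeSum (suc u) g p) (λ _ r → fits r (drop L w'))) (sym lt) ⟩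
  afterTake false (takeSum (suc (length (take L w'))) g p) (λ _ r → fits r (drop L w'))
    ≡⟨ sym (fits-run (length (take L w')) g x (take L w') (drop L w') NP.≤-refl (runLength-IsRun x g w') p) ⟩
  fits p ((x , g) ∷ take L w' ++ drop L w') ≡⟨ cong (λ u → fits p ((x , g) ∷ u)) (LP.take++drop≡id L w') ⟩
  fits p ((x , g) ∷ w') ∎
  where
  open ≡-Reasoning
  L = runLength x g w'
  lt : length (take L w') ≡ L
  lt = trans (LP.length-take L w') (NP.m≤n⇒m⊓n≡m (runLength-≤ x g w'))
  ld : length (drop L w') ≤ k
  ld = NP.≤-trans (NP.≤-reflexive (LP.length-drop L w')) (NP.≤-trans (NP.m∸n≤m (length w') L) l)

co≤Γ≡fits : (w : Word) (p : Comp C2) → (co w ≤Γ p) ≡ fits p w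
co≤Γ≡fits w p = trans (≤Γ≡is-just (co w) p) (co-refines≡fits (length w) w NP.≤-refl p)

mutual
  fits-++ : (p q : Comp C2) (x y : Word) → sum (map proj₁ p) ≡ length x → fits (p ++ q) (x ++ y) ≡ fits p x ∧ fits q y
  fits-++ [] q [] y e = refl
  fits-++ ((zero , a) ∷ p) q x y e = refl
  fits-++ ((suc a , e') ∷ p) q ((y0 , h) ∷ x) y e = trans (cong (does (e' ≟C h) ∧_) (fitsRun-++ a e' y0 x p q y (NP.suc-injective e))) (sym (∧-assoc (does (e' ≟C h)) (fitsRun a e' y0 x p) (fits q y)))

  fitsRun-++ : (a : ℕ) (e : C2) (y0 : ℕ) (x : Word) (p q : Comp C2) (y : Word) → a ℕ.+ sum (map proj₁ p) ≡ length x → fitsRun a e y0 (x ++ y) (p ++ q) ≡ fitsRun a e y0 x p ∧ fits q y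
  fitsRun-++ zero e y0 x p q y l = fits-++ p q x y l
  fitsRun-++ (suc a) e y0 ((z , h) ∷ x) p q y l = trans (cong (continuesRun y0 e (z , h) ∧_) (fitsRun-++ a e z x p q y (NP.suc-injective l))) (sym (∧-assoc (continuesRun y0 e (z , h)) (fitsRun a e z x p) (fits q y)))

mapValues : (ℕ → ℕ) → Word → Word
mapValues f x = map (λ t → (f (proj₁ t) , proj₂ t)) x

module _ (f : ℕ → ℕ) (S : ℕ → Set) (mono : ∀ {y z} → S y → S z → (y <ᵇ z) ≡ (f y <ᵇ f z)) where
  mutual
    fits-relabel : (p : Comp C2) (x : Word) → All S (vals x) → fits p (mapValues f x) ≡ fits p x
    fits-relabel [] [] _ = refl
    fits-relabel [] (_ ∷ _) _ = refl
    fits-relabel ((zero , e) ∷ p) x _ = refl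
    fits-relabel ((suc a , e) ∷ p) [] _ = refl
    fits-relabel ((suc a , e) ∷ p) ((y , h) ∷ x) (sy All.∷ sx) = cong (does (e ≟C h) ∧_) (fitsRun-relabel a e y x p sy sx)

    fitsRun-relabel : (a : ℕ) (e : C2) (y : ℕ) (x : Word) (p : Comp C2) → S y → All S (vals x) → fitsRun a e (f y) (mapValues f x) p ≡ fitsRun a e y x p
    fitsRun-relabel zero e y x p sy sx = fits-relabel p x sx
    fitsRun-relabel (suc a) e y [] p sy sx = refl
    fitsRun-relabel (suc a) e y ((z , h) ∷ x) p sy (sz All.∷ sx) = cong₂ _∧_ (cong (_∧ does (e ≟C h)) (sym (mono sy sz))) (fitsRun-relabel a e z x p sz sx)

shufflePerm : List Bool → List ℕ
shufflePerm b = positions true 1 b ++ positions false 1 b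

shuffle : List Bool → Word → Word → Word
shuffle b u v = actL (shufflePerm b) (cross u v)

InRange : ℕ → ℕ → Set
InRange n y = ∃ λ j → (y ≡ suc j) × (j < n)

elems-InRange : (n : ℕ) {u : Word} → u ∈ elems n → {t : ℕ × C2} → t ∈ u → InRange n (proj₁ t)
elems-InRange n mu mt = ∈-range⁻ (PermP.∈-resp-↭ (elems-↭ n mu) (∈-map⁺ proj₁ mt))

vals-mapValues : (f : ℕ → ℕ) (u : Word) → vals (mapValues f u) ≡ map f (vals u)
vals-mapValues f [] = refl
vals-mapValues f (t ∷ u) = cong (f (proj₁ t) ∷_) (vals-mapValues f u)

length-mapValues : (f : ℕ → ℕ) (u : Word) → length (mapValues f u) ≡ length u
length-mapValues f u = LP.length-map _ u

at-preserves-<ᵇ : (L : List ℕ) (k : ℕ) → Increasing L → length L ≡ k → {y z : ℕ} → InRange k y → InRange k z → (y <ᵇ z) ≡ (at L y <ᵇ at L z)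
at-preserves-<ᵇ L k ip lL {y} {z} (i , refl , il) (j , refl , jl) with NP.<-cmp i j
... | tri< a _ _ = trans (<⇒<ᵇ≡true (s≤s a)) (sym (<⇒<ᵇ≡true (at-monotone L ip a (subst (j <_) (sym lL) jl))))
... | tri≈ _ refl _ = trans (≮⇒<ᵇ≡false {suc i} {suc i} (NP.<-irrefl refl)) (sym (≮⇒<ᵇ≡false {at L (suc i)} {at L (suc i)} (NP.<-irrefl refl)))
... | tri> _ _ c = trans (≮⇒<ᵇ≡false (λ l → NP.<-asym l (s≤s c))) (sym (≮⇒<ᵇ≡false (λ l → NP.<-asym l (at-monotone L ip c (subst (i <_) (sym lL) il)))))

mapValues-at-injective : (k : ℕ) (L : List ℕ) → Increasing L → length L ≡ k → {u u' : Word} → u ∈ elems k → u' ∈ elems k → mapValues (at L) u ≡ mapValues (at L) u' → u ≡ u'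
mapValues-at-injective k L ip lL {u} {u'} mu mu' e = map-injective-∈ (λ t → (at L (proj₁ t) , proj₂ t)) u u' inj e
  where
  inj : ∀ {t t'} → t ∈ u → t' ∈ u' → (at L (proj₁ t) , proj₂ t) ≡ (at L (proj₁ t') , proj₂ t') → t ≡ t'
  inj {t} {t'} mt mt' eq with elems-InRange k mu mt | elems-InRange k mu' mt' | cong proj₁ eq | cong proj₂ eq
  ... | (j , ej , jl) | (j' , ej' , jl') | e1 | e2 =
    cong₂ _,_ (trans ej (trans (cong suc (at-injective L ip (subst (j <_) (sym lL) jl) (subst (j' <_) (sym lL) jl')
                 (trans (cong (at L) (sym ej)) (trans e1 (cong (at L) ej'))))) (sym ej'))) e2

elems-all-InRange : (k : ℕ) {u : Word} → u ∈ elems k → All (InRange k) (vals u)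
elems-all-InRange k mu = All.tabulate (λ {y} my → ∈-range⁻ (PermP.∈-resp-↭ (elems-↭ k mu) my))

module Shuffle (n m : ℕ) {b : List Bool} (mb : b ∈ masks n m) where
  P = positions true 1 b
  Q = positions false 1 b
  lP : length P ≡ n
  lP = proj₁ (masks-lengths n m mb 1)
  lQ : length Q ≡ m
  lQ = proj₁ (proj₂ (masks-lengths n m mb 1))
  lb : length b ≡ n ℕ.+ m
  lb = proj₂ (proj₂ (masks-lengths n m mb 1))

  shuffle-split : {u v : Word} → u ∈ elems n → v ∈ elems m → shuffle b u v ≡ mapValues (at P) u ++ mapValues (at Q) v
  shuffle-split {u} {v} mu mv = trans (LP.map-++ g u (map sft v)) (cong₂ _++_ e1 e2)
    where
    g : ℕ × C2 → ℕ × C2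
    g t = (at (shufflePerm b) (proj₁ t) , proj₂ t)
    sft : ℕ × C2 → ℕ × C2
    sft x = (length u ℕ.+ proj₁ x , proj₂ x)
    e1 : map g u ≡ mapValues (at P) u
    e1 = LP.map-cong-local (All.tabulate λ {t} mt → let (j , ej , jl) = elems-InRange n mu mt in
           cong (_, proj₂ t) (trans (cong (at (shufflePerm b)) ej) (trans (at-++ˡ P Q (subst (j <_) (sym lP) jl)) (cong (at P) (sym ej)))))
    e2 : map g (map sft v) ≡ mapValues (at Q) v
    e2 = trans (sym (LP.map-∘ v)) (LP.map-cong-local (All.tabulate λ {t} mt → let (j , ej , jl) = elems-InRange m mv mt in
           cong (_, proj₂ t) (trans (cong (λ z → at (shufflePerm b) (length u ℕ.+ z)) ej)
             (trans (cong (λ k → at (shufflePerm b) (k ℕ.+ suc j)) (trans (elems-length n mu) (sym lP))) (trans (at-++ʳ P Q j) (cong (at Q) (sym ej)))))))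

  shuffle-∈-elems : {u v : Word} → u ∈ elems n → v ∈ elems m → shuffle b u v ∈ elems (n ℕ.+ m)
  shuffle-∈-elems {u} {v} mu mv = ∈-elems (n ℕ.+ m) (shuffle b u v) (subst (λ z → vals z ↭ range (n ℕ.+ m)) (sym (shuffle-split mu mv)) perm)
    where
    perm : vals (mapValues (at P) u ++ mapValues (at Q) v) ↭ range (n ℕ.+ m)
    perm = ↭-trans (↭-reflexive (trans (LP.map-++ proj₁ (mapValues (at P) u) (mapValues (at Q) v)) (cong₂ _++_ (vals-mapValues (at P) u) (vals-mapValues (at Q) v))))
           (↭-trans (PermP.++⁺ (PermP.map⁺ (at P) (elems-↭ n mu)) (PermP.map⁺ (at Q) (elems-↭ m mv)))
           (↭-trans (↭-reflexive (cong₂ _++_ (trans (cong (λ k → map (at P) (range k)) (sym lP)) (map-at-range P))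
                                                  (trans (cong (λ k → map (at Q) (range k)) (sym lQ)) (map-at-range Q))))
           (↭-trans (positions-↭ 1 b) (↭-reflexive (trans (cong (rangeFrom 1) lb) (sym (range≡rangeFrom (n ℕ.+ m))))))))

  fits-shuffle : (p q : Comp C2) → IsComp n p → {u v : Word} → u ∈ elems n → v ∈ elems m → fits (p ++ q) (shuffle b u v) ≡ fits p u ∧ fits q v
  fits-shuffle p q (_ , sp) {u} {v} mu mv = trans (cong (fits (p ++ q)) (shuffle-split mu mv))
    (trans (fits-++ p q (mapValues (at P) u) (mapValues (at Q) v) (trans sp (sym (trans (length-mapValues (at P) u) (elems-length n mu)))))
    (cong₂ _∧_ (fits-relabel (at P) (InRange n) (at-preserves-<ᵇ P n (positions-increasing true 1 b) lP) p u (elems-all-InRange n mu))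
               (fits-relabel (at Q) (InRange m) (at-preserves-<ᵇ Q m (positions-increasing false 1 b) lQ) q v (elems-all-InRange m mv))))

shuffle-injective : (n m : ℕ) {b b' : List Bool} (mb : b ∈ masks n m) (mb' : b' ∈ masks n m) {u u' v v' : Word} →
  u ∈ elems n → u' ∈ elems n → v ∈ elems m → v' ∈ elems m → shuffle b u v ≡ shuffle b' u' v' → (b ≡ b') × (u ≡ u') × (v ≡ v')
shuffle-injective n m {b} {b'} mb mb' {u} {u'} {v} {v'} mu mu' mv mv' e = bb , uu , vv
  where
  module A = Shuffle n m mb
  module B = Shuffle n m mb'
  e' : mapValues (at A.P) u ++ mapValues (at A.Q) v ≡ mapValues (at B.P) u' ++ mapValues (at B.Q) v'
  e' = trans (sym (A.shuffle-split mu mv)) (trans e (B.shuffle-split mu' mv'))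
  sp = ++-split (mapValues (at A.P) u) (mapValues (at B.P) u') (mapValues (at A.Q) v) (mapValues (at B.Q) v')
         (trans (length-mapValues (at A.P) u) (trans (elems-length n mu) (sym (trans (length-mapValues (at B.P) u') (elems-length n mu'))))) e'
  e1 = proj₁ sp
  e2 = proj₂ sp
  ev : map (at A.P) (vals u) ≡ map (at B.P) (vals u')
  ev = trans (sym (vals-mapValues (at A.P) u)) (trans (cong vals e1) (vals-mapValues (at B.P) u'))
  mar : (L : List ℕ) → length L ≡ n → map (at L) (range n) ≡ L
  mar L lL = trans (cong (λ k → map (at L) (range k)) (sym lL)) (map-at-range L)
  PP : A.P ↭ B.P
  PP = ↭-trans (↭-reflexive (sym (mar A.P A.lP)))
       (↭-trans (PermP.map⁺ (at A.P) (↭-sym (elems-↭ n mu)))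
       (↭-trans (↭-reflexive ev)
       (↭-trans (PermP.map⁺ (at B.P) (elems-↭ n mu')) (↭-reflexive (mar B.P B.lP)))))
  P≡ : A.P ≡ B.P
  P≡ = increasing-↭⇒≡ A.P B.P (positions-increasing true 1 b) (positions-increasing true 1 b') PP
  bb : b ≡ b'
  bb = positions-true-injective 1 b b' P≡ (trans A.lb (sym B.lb))
  uu : u ≡ u'
  uu = mapValues-at-injective n A.P (positions-increasing true 1 b) A.lP mu mu' (trans e1 (cong (λ L → mapValues (at L) u') (sym P≡)))
  vv : v ≡ v'
  vv = mapValues-at-injective m A.Q (positions-increasing false 1 b) A.lQ mv mv' (trans e2 (cong (λ L → mapValues (at (positions false 1 L)) v') (sym bb)))

shufflesOf : ℕ → ℕ → List Word
shufflesOf n m = concatMap (λ u → concatMap (λ v → map (λ b → shuffle b u v) (masks n m)) (elems m)) (elems n)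

shufflesOf-unique : (n m : ℕ) → Unique (shufflesOf n m)
shufflesOf-unique n m = unique-concatMap shufflesWith (elems-unique n)
  (λ {u} mu → unique-concatMap (masksOf u) (elems-unique m)
     (λ {v} mv → unique-map-∈ (λ b → shuffle b u v) (λ mb mb' e → proj₁ (shuffle-injective n m mb mb' mu mu mv mv e)) (masks-unique n m))
     (λ {v} {v'} mv mv' z1 z2 → let (b , mb , e1) = ∈-map⁻ (λ b → shuffle b u v) z1 ; (b' , mb' , e2) = ∈-map⁻ (λ b → shuffle b u v') z2
        in proj₂ (proj₂ (shuffle-injective n m mb mb' mu mu mv mv' (trans (sym e1) e2)))))
  (λ {u} {u'} mu mu' z1 z2 → same-u mu mu' z1 z2)
  where
  masksOf : Word → Word → List Word
  masksOf u v = map (λ b → shuffle b u v) (masks n m)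
  shufflesWith : Word → List Word
  shufflesWith u = concatMap (masksOf u) (elems m)
  same-u : ∀ {u u' z} → u ∈ elems n → u' ∈ elems n → z ∈ shufflesWith u → z ∈ shufflesWith u' → u ≡ u'
  same-u {u} {u'} mu mu' z1 z2 with ∈-concatMap⁻′ {f = masksOf u} (elems m) z1 | ∈-concatMap⁻′ {f = masksOf u'} (elems m) z2
  ... | (v , mv , z1') | (v' , mv' , z2') with ∈-map⁻ (λ b → shuffle b u v) z1' | ∈-map⁻ (λ b → shuffle b u' v') z2'
  ... | (b , mb , e1) | (b' , mb' , e2) = proj₁ (proj₂ (shuffle-injective n m mb mb' mu mu' mv mv' (trans (sym e1) e2)))

shufflesOf-⊆-elems : (n m : ℕ) {x : Word} → x ∈ shufflesOf n m → x ∈ elems (n ℕ.+ m)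
shufflesOf-⊆-elems n m {x} mx with ∈-concatMap⁻′ {f = λ u → concatMap (λ v → map (λ b → shuffle b u v) (masks n m)) (elems m)} (elems n) mx
... | u , mu , mx' with ∈-concatMap⁻′ {f = λ v → map (λ b → shuffle b u v) (masks n m)} (elems m) mx'
... | v , mv , mx'' with ∈-map⁻ (λ b → shuffle b u v) mx''
... | b , mb , refl = Shuffle.shuffle-∈-elems n m mb mu mv

length-shufflesOf : (n m : ℕ) → length (shufflesOf n m) ≡ length (elems (n ℕ.+ m))
length-shufflesOf n m = begin
  length (shufflesOf n m) ≡⟨ length-concatMap-const _ (length (elems m) ℕ.* length (masks n m)) (elems n)
                       (λ _ → length-concatMap-const _ (length (masks n m)) (elems m) (λ _ → LP.length-map _ (masks n m))) ⟩
  length (elems n) ℕ.* (length (elems m) ℕ.* M) ≡⟨ cong₂ (λ a c → a ℕ.* (c ℕ.* M)) (length-elems n) (length-elems m) ⟩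
  (n ! ℕ.* 2 ^ n) ℕ.* ((m ! ℕ.* 2 ^ m) ℕ.* M) ≡⟨ regroup (n !) (m !) (2 ^ n) (2 ^ m) M ⟩
  (M ℕ.* (n ! ℕ.* m !)) ℕ.* (2 ^ n ℕ.* 2 ^ m) ≡⟨ cong₂ ℕ._*_ (masks-count n m) (sym (NP.^-distribˡ-+-* 2 n m)) ⟩
  (n ℕ.+ m) ! ℕ.* 2 ^ (n ℕ.+ m) ≡⟨ sym (length-elems (n ℕ.+ m)) ⟩
  length (elems (n ℕ.+ m)) ∎
  where
  open ≡-Reasoning
  M = length (masks n m)
  regroup : ∀ a c x y M → (a ℕ.* x) ℕ.* ((c ℕ.* y) ℕ.* M) ≡ (M ℕ.* (a ℕ.* c)) ℕ.* (x ℕ.* y)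
  regroup = NS.solve-∀

∑δ-shufflesOf : (n m : ℕ) (w : Word) → ∑ (δ w) (shufflesOf n m) ≡ ∑ (δ w) (elems (n ℕ.+ m))
∑δ-shufflesOf n m w = ∑δ-same-elements (shufflesOf n m) (elems (n ℕ.+ m)) (shufflesOf-unique n m) (elems-unique (n ℕ.+ m)) (shufflesOf-⊆-elems n m)
  (unique-⊆-length-≥⇒⊇ _≟W_ (shufflesOf n m) (elems (n ℕ.+ m)) (shufflesOf-unique n m) (shufflesOf-⊆-elems n m) (NP.≤-reflexive (sym (length-shufflesOf n m)))) w

co-IsComp : (k : ℕ) (w : Word) → length w ≤ k → IsComp (length w) (co w)
co-IsComp k [] _ = All.[] , refl
co-IsComp (suc k) ((x , g) ∷ w') (s≤s l) = subst (IsComp (suc (length w'))) (sym (coGo-eq x g 1 w'))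
  ((s≤s z≤n) All.∷ proj₁ ih , cong suc (trans (cong (L ℕ.+_) (proj₂ ih)) (trans (cong (L ℕ.+_) (LP.length-drop L w')) (NP.m+[n∸m]≡n (runLength-≤ x g w')))))
  where
  L = runLength x g w'
  ih = co-IsComp k (drop L w') (NP.≤-trans (NP.≤-reflexive (LP.length-drop L w')) (NP.≤-trans (NP.m∸n≤m (length w') L) l))

_≟Γ_ : DecidableEquality (Comp C2)
_≟Γ_ = LP.≡-dec decC2

lin-X : (n : ℕ) (p : Comp C2) (F : Word → ℚ) → lin F (X n p) ≡ ∑ (λ u → 𝟙 (co u ≤Γ p) * F u) (elems n)
lin-X n p F = begin
  lin F (X n p) ≡⟨ lin-concatMap F (Y n) (filter (λ q → q ≤Γ p) Γn) ⟩
  ∑ (λ q → lin F (Y n q)) (filter (λ q → q ≤Γ p) Γn) ≡⟨ ∑-filter (λ q → q ≤Γ p) (λ q → lin F (Y n q)) Γn ⟩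
  ∑ (λ q → 𝟙 (q ≤Γ p) * lin F (Y n q)) Γn
    ≡⟨ ∑-cong (λ q → cong (𝟙 (q ≤Γ p) *_) (trans (lin-units F (filter (λ w → does (_≟Γ_ (co w) q)) (elems n))) (∑-filter (λ w → does (_≟Γ_ (co w) q)) F (elems n)))) Γn ⟩
  ∑ (λ q → 𝟙 (q ≤Γ p) * ∑ (λ u → 𝟙 (does (_≟Γ_ (co u) q)) * F u) (elems n)) Γn
    ≡⟨ ∑-cong (λ q → sym (∑-*ˡ (𝟙 (q ≤Γ p)) _ (elems n))) Γn ⟩
  ∑ (λ q → ∑ (λ u → 𝟙 (q ≤Γ p) * (𝟙 (does (_≟Γ_ (co u) q)) * F u)) (elems n)) Γn
    ≡⟨ ∑-swap (λ q u → 𝟙 (q ≤Γ p) * (𝟙 (does (_≟Γ_ (co u) q)) * F u)) Γn (elems n) ⟩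
  ∑ (λ u → ∑ (λ q → 𝟙 (q ≤Γ p) * (𝟙 (does (_≟Γ_ (co u) q)) * F u)) Γn) (elems n)
    ≡⟨ ∑-cong-∈ (elems n) (λ {u} mu → trans (∑-cong (pt u) Γn) (∑-select-∈ _≟Γ_ (λ q → 𝟙 (q ≤Γ p) * F u) (co u) Γn (compsAux-unique n n) (inΓ mu))) ⟩
  ∑ (λ u → 𝟙 (co u ≤Γ p) * F u) (elems n) ∎
  where
  open ≡-Reasoning
  Γn = Γ allC2 n
  pt : (u : Word) (q : Comp C2) → 𝟙 (q ≤Γ p) * (𝟙 (does (_≟Γ_ (co u) q)) * F u) ≡ (if does (_≟Γ_ (co u) q) then 𝟙 (q ≤Γ p) * F u else 0ℚ)
  pt u q with _≟Γ_ (co u) q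
  ... | yes _ = cong (𝟙 (q ≤Γ p) *_) (QP.*-identityˡ (F u))
  ... | no _ = trans (cong (𝟙 (q ≤Γ p) *_) (QP.*-zeroˡ (F u))) (QP.*-zeroʳ (𝟙 (q ≤Γ p)))
  inΓ : {u : Word} → u ∈ elems n → co u ∈ Γn
  inΓ {u} mu = compsAux-complete n n (co u) (subst (λ k → IsComp k (co u)) (elems-length n mu) (co-IsComp (length u) u NP.≤-refl)) NP.≤-refl

coeff-starW : (u v w : Word) → coeff (starW u v) w ≡ ∑ (λ b → δ w (shuffle b u v)) (masks (length u) (length v))
coeff-starW u v w = trans (coeff≡lin-δ (starW u v) w)
  (trans (∑-map _ (λ s → (1ℚ , actL s (cross u v))) (shuffles (length u) (length v)))
  (trans (∑-cong (λ s → QP.*-identityˡ _) (shuffles (length u) (length v)))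
  (∑-map (λ s → δ w (actL s (cross u v))) shufflePerm (masks (length u) (length v)))))

𝟙-∧ : (a c : Bool) → 𝟙 (a ∧ c) ≡ 𝟙 a * 𝟙 c
𝟙-∧ true c = sym (QP.*-identityˡ (𝟙 c))
𝟙-∧ false c = sym (QP.*-zeroˡ (𝟙 c))

∑-shufflesOf : (n m : ℕ) (f : Word → ℚ) →
  ∑ f (shufflesOf n m) ≡ ∑ (λ u → ∑ (λ v → ∑ (λ b → f (shuffle b u v)) (masks n m)) (elems m)) (elems n)
∑-shufflesOf n m f = trans (∑-concatMap f _ (elems n))
  (∑-cong (λ u → trans (∑-concatMap f _ (elems m)) (∑-cong (λ v → ∑-map f (λ b → shuffle b u v) (masks n m)) (elems m))) (elems n))

coeff-X : (n : ℕ) (p : Comp C2) (w : Word) → coeff (X n p) w ≡ 𝟙 (co w ≤Γ p) * ∑ (δ w) (elems n)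
coeff-X n p w = begin
  coeff (X n p) w                              ≡⟨ coeff≡lin-δ (X n p) w ⟩
  lin (δ w) (X n p)                            ≡⟨ lin-X n p (δ w) ⟩
  ∑ (λ x → 𝟙 (co x ≤Γ p) * δ w x) (elems n)    ≡⟨ ∑-cong only-w (elems n) ⟩
  ∑ (λ x → 𝟙 (co w ≤Γ p) * δ w x) (elems n)    ≡⟨ ∑-*ˡ (𝟙 (co w ≤Γ p)) (δ w) (elems n) ⟩
  𝟙 (co w ≤Γ p) * ∑ (δ w) (elems n) ∎
  where
  only-w : (x : Word) → 𝟙 (co x ≤Γ p) * δ w x ≡ 𝟙 (co w ≤Γ p) * δ w x
  only-w x with x ≟W w
  ... | yes refl = refl
  ... | no _ = trans (QP.*-zeroʳ (𝟙 (co x ≤Γ p))) (sym (QP.*-zeroʳ (𝟙 (co w ≤Γ p))))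

coeff-X⋆X : (n m : ℕ) (p q : Comp C2) (w : Word) →
  coeff (X n p ⋆ X m q) w ≡ ∑ (λ u → ∑ (λ v → ∑ (λ b → 𝟙 (co u ≤Γ p) * (𝟙 (co v ≤Γ q) * δ w (shuffle b u v))) (masks n m)) (elems m)) (elems n)
coeff-X⋆X n m p q w = begin
  coeff (X n p ⋆ X m q) w                                                        ≡⟨ coeff-⋆ (X n p) (X m q) w ⟩
  lin (λ u → lin (λ v → coeff (starW u v) w) (X m q)) (X n p)                    ≡⟨ lin-X n p _ ⟩
  ∑ (λ u → 𝟙 (co u ≤Γ p) * lin (λ v → coeff (starW u v) w) (X m q)) (elems n) ≡⟨ ∑-cong-∈ (elems n) over-v ⟩
  ∑ (λ u → ∑ (λ v → ∑ (λ b → 𝟙 (co u ≤Γ p) * (𝟙 (co v ≤Γ q) * δ w (shuffle b u v))) (masks n m)) (elems m)) (elems n) ∎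
  where
  over-b : ∀ {u v} → u ∈ elems n → v ∈ elems m → 𝟙 (co u ≤Γ p) * (𝟙 (co v ≤Γ q) * coeff (starW u v) w)
    ≡ ∑ (λ b → 𝟙 (co u ≤Γ p) * (𝟙 (co v ≤Γ q) * δ w (shuffle b u v))) (masks n m)
  over-b {u} {v} mu mv = begin
    𝟙 (co u ≤Γ p) * (𝟙 (co v ≤Γ q) * coeff (starW u v) w)
      ≡⟨ cong (λ z → 𝟙 (co u ≤Γ p) * (𝟙 (co v ≤Γ q) * z)) (coeff-starW u v w) ⟩
    𝟙 (co u ≤Γ p) * (𝟙 (co v ≤Γ q) * ∑ (λ b → δ w (shuffle b u v)) (masks (length u) (length v)))
      ≡⟨ cong₂ (λ k l → 𝟙 (co u ≤Γ p) * (𝟙 (co v ≤Γ q) * ∑ (λ b → δ w (shuffle b u v)) (masks k l))) (elems-length n mu) (elems-length m mv) ⟩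
    𝟙 (co u ≤Γ p) * (𝟙 (co v ≤Γ q) * ∑ (λ b → δ w (shuffle b u v)) (masks n m))
      ≡⟨ cong (𝟙 (co u ≤Γ p) *_) (∑-*ˡ (𝟙 (co v ≤Γ q)) _ (masks n m)) ⟨
    𝟙 (co u ≤Γ p) * ∑ (λ b → 𝟙 (co v ≤Γ q) * δ w (shuffle b u v)) (masks n m)
      ≡⟨ ∑-*ˡ (𝟙 (co u ≤Γ p)) _ (masks n m) ⟨
    ∑ (λ b → 𝟙 (co u ≤Γ p) * (𝟙 (co v ≤Γ q) * δ w (shuffle b u v))) (masks n m) ∎
  over-v : ∀ {u} → u ∈ elems n → 𝟙 (co u ≤Γ p) * lin (λ v → coeff (starW u v) w) (X m q)
    ≡ ∑ (λ v → ∑ (λ b → 𝟙 (co u ≤Γ p) * (𝟙 (co v ≤Γ q) * δ w (shuffle b u v))) (masks n m)) (elems m)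
  over-v {u} mu = begin
    𝟙 (co u ≤Γ p) * lin (λ v → coeff (starW u v) w) (X m q)                      ≡⟨ cong (𝟙 (co u ≤Γ p) *_) (lin-X m q _) ⟩
    𝟙 (co u ≤Γ p) * ∑ (λ v → 𝟙 (co v ≤Γ q) * coeff (starW u v) w) (elems m)     ≡⟨ ∑-*ˡ (𝟙 (co u ≤Γ p)) _ (elems m) ⟨
    ∑ (λ v → 𝟙 (co u ≤Γ p) * (𝟙 (co v ≤Γ q) * coeff (starW u v) w)) (elems m)   ≡⟨ ∑-cong-∈ (elems m) (over-b mu) ⟩
    ∑ (λ v → ∑ (λ b → 𝟙 (co u ≤Γ p) * (𝟙 (co v ≤Γ q) * δ w (shuffle b u v))) (masks n m)) (elems m) ∎

-- A shuffle keeps the relative order of the values coming from u and from v, so it fits p ++ q iff u fits p and v fits q.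
𝟙-co-shuffle : (n m : ℕ) (p q : Comp C2) → IsComp n p → {b : List Bool} {u v : Word} → b ∈ masks n m → u ∈ elems n → v ∈ elems m →
  𝟙 (co u ≤Γ p) * 𝟙 (co v ≤Γ q) ≡ 𝟙 (co (shuffle b u v) ≤Γ (p ++ q))
𝟙-co-shuffle n m p q icp {b} {u} {v} mb mu mv = begin
  𝟙 (co u ≤Γ p) * 𝟙 (co v ≤Γ q)       ≡⟨ 𝟙-∧ (co u ≤Γ p) (co v ≤Γ q) ⟨
  𝟙 ((co u ≤Γ p) ∧ (co v ≤Γ q))       ≡⟨ cong 𝟙 (cong₂ _∧_ (co≤Γ≡fits u p) (co≤Γ≡fits v q)) ⟩
  𝟙 (fits p u ∧ fits q v)             ≡⟨ cong 𝟙 (Shuffle.fits-shuffle n m mb p q icp mu mv) ⟨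
  𝟙 (fits (p ++ q) (shuffle b u v))   ≡⟨ cong 𝟙 (co≤Γ≡fits (shuffle b u v) (p ++ q)) ⟨
  𝟙 (co (shuffle b u v) ≤Γ (p ++ q)) ∎

X⋆X≈X : (n m : ℕ) (p q : Comp C2) → IsComp n p → (X n p ⋆ X m q) ≈A X (n ℕ.+ m) (p ++ q)
X⋆X≈X n m p q icp w = begin
  coeff (X n p ⋆ X m q) w                                                      ≡⟨ coeff-X⋆X n m p q w ⟩
  ∑ (λ u → ∑ (λ v → ∑ (λ b → 𝟙 (co u ≤Γ p) * (𝟙 (co v ≤Γ q) * δ w (shuffle b u v))) M) Em) En
    ≡⟨ ∑-cong-∈ En (λ mu → ∑-cong-∈ Em (λ mv → ∑-cong-∈ M (λ mb → weight mu mv mb))) ⟩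
  ∑ (λ u → ∑ (λ v → ∑ (λ b → C * δ w (shuffle b u v)) M) Em) En
    ≡⟨ ∑-cong (λ u → trans (∑-cong (λ v → ∑-*ˡ C _ M) Em) (∑-*ˡ C _ Em)) En ⟩
  ∑ (λ u → C * ∑ (λ v → ∑ (λ b → δ w (shuffle b u v)) M) Em) En               ≡⟨ ∑-*ˡ C _ En ⟩
  C * ∑ (λ u → ∑ (λ v → ∑ (λ b → δ w (shuffle b u v)) M) Em) En               ≡⟨ cong (C *_) (∑-shufflesOf n m (δ w)) ⟨
  C * ∑ (δ w) (shufflesOf n m)                                                 ≡⟨ cong (C *_) (∑δ-shufflesOf n m w) ⟩
  C * ∑ (δ w) (elems (n ℕ.+ m))                                                ≡⟨ coeff-X (n ℕ.+ m) (p ++ q) w ⟨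
  coeff (X (n ℕ.+ m) (p ++ q)) w ∎
  where
  En = elems n
  Em = elems m
  M = masks n m
  C = 𝟙 (co w ≤Γ (p ++ q))
  weight : ∀ {u v b} → u ∈ En → v ∈ Em → b ∈ M → 𝟙 (co u ≤Γ p) * (𝟙 (co v ≤Γ q) * δ w (shuffle b u v)) ≡ C * δ w (shuffle b u v)
  weight {u} {v} {b} mu mv mb with shuffle b u v ≟W w
  ... | yes refl = trans (sym (QP.*-assoc (𝟙 (co u ≤Γ p)) (𝟙 (co v ≤Γ q)) 1ℚ)) (cong (_* 1ℚ) (𝟙-co-shuffle n m p q icp mb mu mv))
  ... | no _ = trans (cong (𝟙 (co u ≤Γ p) *_) (QP.*-zeroʳ (𝟙 (co v ≤Γ q)))) (trans (QP.*-zeroʳ (𝟙 (co u ≤Γ p))) (sym (QP.*-zeroʳ C)))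

takeSum-length : (a : ℕ) (e : C2) (q : Comp C2) {d : ℕ} {r : Comp C2} → takeSum a e q ≡ just (d , r) → (1 ≤ d) × (length q ≡ d ℕ.+ length r)
takeSum-length a e [] ()
takeSum-length a e ((b , h) ∷ q) eq with does (e ≟C h) ∧ (b ≤ᵇ a) ∧ (1 ≤ᵇ b)
takeSum-length a e ((b , h) ∷ q) () | false
... | true with b ≡ᵇ a
takeSum-length a e ((b , h) ∷ q) refl | true | true = s≤s z≤n , refl
... | false with takeSum (a ∸ b) e q in eq2
takeSum-length a e ((b , h) ∷ q) () | true | false | nothing
takeSum-length a e ((b , h) ∷ q) refl | true | false | just (d , r) = s≤s z≤n , cong suc (proj₂ (takeSum-length (a ∸ b) e q eq2))

refineDeg-length : (p r : Comp C2) {D : ℕ} → refineDeg p r ≡ just D → (1 ≤ D) × (length p ≤ length r)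
refineDeg-length [] [] refl = s≤s z≤n , z≤n
refineDeg-length [] (_ ∷ _) ()
refineDeg-length ((a , e) ∷ p) r eq with takeSum a e r in eq1
refineDeg-length ((a , e) ∷ p) r () | nothing
... | just (d , r') with refineDeg p r' in eq2
refineDeg-length ((a , e) ∷ p) r () | just (d , r') | nothing
refineDeg-length ((a , e) ∷ p) r refl | just (d , r') | just D =
  let (d1 , l1) = takeSum-length a e r eq1 ; (D1 , l2) = refineDeg-length p r' eq2
  in NP.*-mono-≤ d1 D1 , NP.≤-trans (s≤s l2) (NP.≤-trans (NP.+-monoˡ-≤ (length r') d1) (NP.≤-reflexive (sym l1)))

onJust-refineDeg-cons : (a : ℕ) (e : C2) (p q : Comp C2) (F : ℕ → ℚ) →
  onJust (refineDeg ((a , e) ∷ p) q) F ≡ afterTake 0ℚ (takeSum a e q) (λ d r → onJust (refineDeg p r) (λ D → F (d ℕ.* D)))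
onJust-refineDeg-cons a e p q F with takeSum a e q
... | nothing = refl
... | just (d , r) with refineDeg p r
...   | nothing = refl
...   | just D = refl

∸-∸-cancel : (M a b : ℕ) → b ≤ a → M ∸ b ∸ (a ∸ b) ≡ M ∸ a
∸-∸-cancel M a b le = trans (NP.∸-+-assoc M b (a ∸ b)) (cong (M ∸_) (NP.m+[n∸m]≡n le))

∸-suc : (a b : ℕ) → b < a → a ∸ b ≡ suc (a ∸ suc b)
∸-suc (suc a) zero _ = refl
∸-suc (suc a) (suc b) (s≤s l) = ∸-suc a b l

𝟙-≟C-refl : (e : C2) (x : Bool) → 𝟙 (does (e ≟C e) ∧ x) ≡ 𝟙 x
𝟙-≟C-refl e x rewrite ≟C-refl e = refl

-- A bounds the depth of the recursion only.
∑-afterTake : (A a N : ℕ) (e : C2) (K : Comp C2 → ℕ → Comp C2 → ℚ) → suc a ≤ N → a < A →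
  ∑ (λ q → afterTake 0ℚ (takeSum (suc a) e q) (K q)) (Γ allC2 N) ≡ ∑ (λ q1 → ∑ (λ r → K (q1 ++ r) (length q1) r) (Γ allC2 (N ∸ suc a))) (filter (allLabel e) (Γ allC2 (suc a)))
∑-afterTake (suc A) a (suc M) e K (s≤s aM) (s≤s aA) = begin
  ∑ (λ q → afterTake 0ℚ (takeSum (suc a) e q) (K q)) (Γ allC2 (suc M)) ≡⟨ ∑-Γ-suc M _ ⟩
  ∑ takenAt (upTo (suc M)) ≡⟨ ∑-upTo-truncate takenAt (suc a) (suc M) (s≤s aM) takenAt-too-long ⟩
  ∑ takenAt (upTo (suc a)) ≡⟨ ∑-cong-∈ (upTo (suc a)) (λ {b} mb → ∑-cong (taken≡split b (NP.≤-pred (∈-upTo⁻ mb))) allC2) ⟩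
  ∑ splitAt (upTo (suc a)) ≡⟨ sym (∑-Γ-suc a _) ⟩
  ∑ (λ q1 → 𝟙 (allLabel e q1) * tailSum q1) (Γ allC2 (suc a)) ≡⟨ sym (∑-filter (allLabel e) tailSum (Γ allC2 (suc a))) ⟩
  ∑ tailSum (filter (allLabel e) (Γ allC2 (suc a))) ∎
  where
  open ≡-Reasoning
  tailSum : Comp C2 → ℚ
  tailSum q1 = ∑ (λ r → K (q1 ++ r) (length q1) r) (Γ allC2 (M ∸ a))
  taken : ℕ → C2 → ℚ
  taken b h = ∑ (λ r' → afterTake 0ℚ (takeSum (suc a) e ((suc b , h) ∷ r')) (K ((suc b , h) ∷ r'))) (Γ allC2 (M ∸ b))
  takenAt : ℕ → ℚ
  takenAt b = ∑ (taken b) allC2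
  split : ℕ → C2 → ℚ
  split b h = ∑ (λ q1' → 𝟙 (allLabel e ((suc b , h) ∷ q1')) * tailSum ((suc b , h) ∷ q1')) (Γ allC2 (a ∸ b))
  splitAt : ℕ → ℚ
  splitAt b = ∑ (split b) allC2
  takenAt-too-long : ∀ b → suc a ≤ b → takenAt b ≡ 0ℚ
  takenAt-too-long b le = ∑-zero (λ h → ∑-zero (λ r' → z h r') (Γ allC2 (M ∸ b))) allC2
    where
    z : ∀ h r' → afterTake 0ℚ (takeSum (suc a) e ((suc b , h) ∷ r')) (K ((suc b , h) ∷ r')) ≡ 0ℚ
    z h r' with toSum (e ≟C h)
    ... | inj₁ refl = afterTake-too-big 0ℚ {suc a} {e} {suc b} r' (K ((suc b , e) ∷ r')) (s≤s le)
    ... | inj₂ ne = afterTake-label≢ 0ℚ r' (K ((suc b , h) ∷ r')) ne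
  taken≡split : ∀ b → b ≤ a → ∀ h → taken b h ≡ split b h
  taken≡split b ba h with toSum (e ≟C h)
  ... | inj₂ ne = trans (∑-zero (λ r' → afterTake-label≢ 0ℚ r' (K ((suc b , h) ∷ r')) ne) (Γ allC2 (M ∸ b)))
                     (sym (∑-zero (λ q1' → trans (cong (λ x → 𝟙 (x ∧ allLabel e q1') * tailSum ((suc b , h) ∷ q1')) (≟C-≢ ne)) (QP.*-zeroˡ (tailSum ((suc b , h) ∷ q1')))) (Γ allC2 (a ∸ b))))
  ... | inj₁ refl with NP.<-cmp b a
  ...   | tri> _ _ c = ⊥-elim (NP.<⇒≱ c ba)
  ...   | tri≈ _ refl _ = begin
      taken b e ≡⟨ ∑-cong (λ r' → afterTake-exact 0ℚ {e} b r' (K ((suc b , e) ∷ r'))) (Γ allC2 (M ∸ b)) ⟩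
      tailSum ((suc b , e) ∷ []) ≡⟨ sym (QP.+-identityʳ _) ⟩
      tailSum ((suc b , e) ∷ []) + 0ℚ
        ≡⟨ cong (_+ 0ℚ) (sym (trans (cong (_* tailSum ((suc b , e) ∷ [])) (𝟙-≟C-refl e true)) (QP.*-identityˡ (tailSum ((suc b , e) ∷ []))))) ⟩
      𝟙 (allLabel e ((suc b , e) ∷ [])) * tailSum ((suc b , e) ∷ []) + 0ℚ
        ≡⟨ cong (λ k → ∑ (λ q1' → 𝟙 (allLabel e ((suc b , e) ∷ q1')) * tailSum ((suc b , e) ∷ q1')) (Γ allC2 k)) (sym (NP.n∸n≡0 b)) ⟩
      split b e ∎
  ...   | tri< lt _ _ = begin
      taken b e ≡⟨ ∑-cong (λ r' → afterTake-partial 0ℚ {suc a} {e} {suc b} r' (K ((suc b , e) ∷ r')) (s≤s z≤n) (s≤s lt)) (Γ allC2 (M ∸ b)) ⟩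
      ∑ (λ r' → afterTake 0ℚ (takeSum (a ∸ b) e r') (K⁺ r')) (Γ allC2 (M ∸ b))
        ≡⟨ cong (λ k → ∑ (λ r' → afterTake 0ℚ (takeSum k e r') (K⁺ r')) (Γ allC2 (M ∸ b))) a∸b≡1+t ⟩
      ∑ (λ r' → afterTake 0ℚ (takeSum (suc t) e r') (K⁺ r')) (Γ allC2 (M ∸ b)) ≡⟨ ∑-afterTake A t (M ∸ b) e K⁺ t≤M∸b t<A ⟩
      ∑ (λ q1 → ∑ (λ r → K⁺ (q1 ++ r) (length q1) r) (Γ allC2 (M ∸ b ∸ suc t))) (filter (allLabel e) (Γ allC2 (suc t)))
        ≡⟨ cong (λ k → ∑ (λ q1 → ∑ (λ r → K⁺ (q1 ++ r) (length q1) r) (Γ allC2 k)) (filter (allLabel e) (Γ allC2 (suc t)))) (trans (cong (M ∸ b ∸_) (sym a∸b≡1+t)) (∸-∸-cancel M a b ba)) ⟩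
      ∑ (λ q1' → tailSum ((suc b , e) ∷ q1')) (filter (allLabel e) (Γ allC2 (suc t)))
        ≡⟨ ∑-filter (allLabel e) (λ q1' → tailSum ((suc b , e) ∷ q1')) (Γ allC2 (suc t)) ⟩
      ∑ (λ q1' → 𝟙 (allLabel e q1') * tailSum ((suc b , e) ∷ q1')) (Γ allC2 (suc t))
        ≡⟨ ∑-cong (λ q1' → cong (_* tailSum ((suc b , e) ∷ q1')) (sym (𝟙-≟C-refl e (allLabel e q1')))) (Γ allC2 (suc t)) ⟩
      ∑ (λ q1' → 𝟙 (allLabel e ((suc b , e) ∷ q1')) * tailSum ((suc b , e) ∷ q1')) (Γ allC2 (suc t))
        ≡⟨ cong (λ k → ∑ (λ q1' → 𝟙 (allLabel e ((suc b , e) ∷ q1')) * tailSum ((suc b , e) ∷ q1')) (Γ allC2 k)) (sym a∸b≡1+t) ⟩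
      split b e ∎
    where
    t = a ∸ suc b
    a∸b≡1+t : a ∸ b ≡ suc t
    a∸b≡1+t = ∸-suc a b lt
    K⁺ : Comp C2 → ℕ → Comp C2 → ℚ
    K⁺ q d r = K ((suc b , e) ∷ q) (suc d) r
    t≤M∸b : suc t ≤ M ∸ b
    t≤M∸b = subst (_≤ M ∸ b) a∸b≡1+t (NP.∸-monoˡ-≤ b aM)
    t<A : t < A
    t<A = NP.<-≤-trans (NP.<-≤-trans (NP.n<1+n t) (NP.≤-reflexive (sym a∸b≡1+t))) (NP.≤-trans (NP.m∸n≤m a b) aA)

ofShape : ℕ → Comp C2^ → List (Comp C2)
ofShape n α = filter (λ p → does (LP.≡-dec ℕ._≟_ (shape p) (shape α))) (Γ allC2 n)

∑-ofShape-cons : (a n' : ℕ) (c : C2^) (α' : Comp C2^) (F : Comp C2 → ℚ) →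
  ∑ F (ofShape (suc a ℕ.+ n') ((suc a , c) ∷ α')) ≡ ∑ (λ h → ∑ (λ p' → F ((suc a , h) ∷ p')) (ofShape n' α')) allC2
∑-ofShape-cons a n' c α' F = begin
  ∑ F (ofShape (suc a ℕ.+ n') α) ≡⟨ ∑-filter hasShape F (Γ allC2 (suc a ℕ.+ n')) ⟩
  ∑ (λ p → 𝟙 (hasShape p) * F p) (Γ allC2 (suc (a ℕ.+ n'))) ≡⟨ ∑-Γ-suc (a ℕ.+ n') _ ⟩
  ∑ firstPart (upTo (suc (a ℕ.+ n')))
    ≡⟨ ∑-single ℕ._≟_ firstPart a (upTo (suc (a ℕ.+ n'))) (UniqueP.upTo⁺ _) (∈-upTo⁺ (s≤s (NP.m≤m+n a n'))) firstPart-≢ ⟩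
  firstPart a ≡⟨ cong (λ k → ∑ (λ h → ∑ (λ r → 𝟙 (hasShape ((suc a , h) ∷ r)) * F ((suc a , h) ∷ r)) (Γ allC2 k)) allC2) (NP.m+n∸m≡n a n') ⟩
  ∑ (λ h → ∑ (λ r → 𝟙 (hasShape ((suc a , h) ∷ r)) * F ((suc a , h) ∷ r)) (Γ allC2 n')) allC2
    ≡⟨ ∑-cong (λ h → trans (∑-cong (λ r → cong (λ x → 𝟙 (x ∧ hasShape' r) * F ((suc a , h) ∷ r)) (≡ᵇ-refl a)) (Γ allC2 n'))
                      (sym (∑-filter hasShape' (λ p' → F ((suc a , h) ∷ p')) (Γ allC2 n')))) allC2 ⟩
  ∑ (λ h → ∑ (λ p' → F ((suc a , h) ∷ p')) (ofShape n' α')) allC2 ∎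
  where
  open ≡-Reasoning
  α = (suc a , c) ∷ α'
  hasShape : Comp C2 → Bool
  hasShape p = does (LP.≡-dec ℕ._≟_ (shape p) (shape α))
  hasShape' : Comp C2 → Bool
  hasShape' p = does (LP.≡-dec ℕ._≟_ (shape p) (shape α'))
  firstPart : ℕ → ℚ
  firstPart b = ∑ (λ h → ∑ (λ r → 𝟙 (hasShape ((suc b , h) ∷ r)) * F ((suc b , h) ∷ r)) (Γ allC2 (a ℕ.+ n' ∸ b))) allC2
  firstPart-≢ : ∀ b → b ≢ a → firstPart b ≡ 0ℚ
  firstPart-≢ b ne = ∑-zero (λ h → ∑-zero (λ r → trans (cong (λ x → 𝟙 (x ∧ hasShape' r) * F ((suc b , h) ∷ r)) (≢⇒≡ᵇ-false ne)) (QP.*-zeroˡ (F ((suc b , h) ∷ r)))) (Γ allC2 (a ℕ.+ n' ∸ b))) allC2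

refinementCoeff : Comp C2 → Comp C2 → ℕ → ℚ
refinementCoeff p q D = negOnePow (length q ∸ length p) * invℕ D

refinementTerm : ℕ → Comp C2 → Comp C2 → Maybe ℕ → Alg
refinementTerm n p q nothing = []
refinementTerm n p q (just d) = scale (refinementCoeff p q d) (X n q)

-- 2^ℓ(α) 𝓘_α in the paper's form: ∑_{|p| = |α|} α(p) ∑_{p ≤ q} (−1)^(ℓ(q)−ℓ(p)) / deg(q/p) · X_q.
expansion : ℕ → Comp C2^ → Alg
expansion n α = concatMap (λ p → scale (evalChar α p) (concatMap (λ q → refinementTerm n p q (refineDeg p q)) (Γ allC2 n))) (ofShape n α)

lin-refinementTerm : (G : Word → ℚ) (n : ℕ) (p q : Comp C2) (m : Maybe ℕ) → lin G (refinementTerm n p q m) ≡ onJust m (λ D → refinementCoeff p q D * lin G (X n q))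
lin-refinementTerm G n p q nothing = refl
lin-refinementTerm G n p q (just D) = lin-scale G (refinementCoeff p q D) (X n q)

lin-expansion : (G : Word → ℚ) (n : ℕ) (α : Comp C2^) → lin G (expansion n α)
  ≡ ∑ (λ p → evalChar α p * ∑ (λ q → onJust (refineDeg p q) (λ D → refinementCoeff p q D * lin G (X n q))) (Γ allC2 n)) (ofShape n α)
lin-expansion G n α = trans (lin-concatMap G (λ p → scale (evalChar α p) (inn p)) (ofShape n α)) (∑-cong (λ p → trans (lin-scale G (evalChar α p) (inn p))
  (cong (evalChar α p *_) (trans (lin-concatMap G (λ q → refinementTerm n p q (refineDeg p q)) (Γ allC2 n)) (∑-cong (λ q → lin-refinementTerm G n p q (refineDeg p q)) (Γ allC2 n))))) (ofShape n α))
  where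
  inn : Comp C2 → Alg
  inn p = concatMap (λ q → refinementTerm n p q (refineDeg p q)) (Γ allC2 n)

logCoeff : Comp C2 → ℚ
logCoeff q = negOnePow (length q ∸ 1) * invℕ (length q)

lin-rr : (G : Word → ℚ) (e : C2) (a : ℕ) → lin G (rr e a) ≡ ∑ (λ q1 → logCoeff q1 * lin G (X a q1)) (filter (allLabel e) (Γ allC2 a))
lin-rr G e a = trans (lin-concatMap G (λ q1 → scale (logCoeff q1) (X a q1)) (filter (allLabel e) (Γ allC2 a))) (∑-cong (λ q1 → lin-scale G (logCoeff q1) (X a q1)) (filter (allLabel e) (Γ allC2 a)))

½ : ℚ
½ = ℤ.+ 1 / 2

lin-Ipart : (G : Word → ℚ) (a : ℕ) (c : C2^) → lin G (Ipart (a , c)) ≡ ½ * ∑ (λ e → chi c e * lin G (rr e a)) allC2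
lin-Ipart G a trv = trans (lin-scale G ½ (rr plus a ++ rr minus a)) (cong (½ *_) (trans (lin-++ G (rr plus a) (rr minus a))
  (sym (trans (∑-allC2 (λ e → chi trv e * lin G (rr e a))) (cong₂ _+_ (QP.*-identityˡ (lin G (rr plus a))) (QP.*-identityˡ (lin G (rr minus a))))))))
lin-Ipart G a sgn = trans (lin-scale G ½ (rr plus a ++ scale (- 1ℚ) (rr minus a))) (cong (½ *_) (trans (lin-++ G (rr plus a) (scale (- 1ℚ) (rr minus a)))
  (trans (cong (λ t → lin G (rr plus a) + t) (lin-scale G (- 1ℚ) (rr minus a)))
  (sym (trans (∑-allC2 (λ e → chi sgn e * lin G (rr e a))) (cong (_+ (- 1ℚ * lin G (rr minus a))) (QP.*-identityˡ (lin G (rr plus a)))))))))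

tailTerm : ℕ → Word → Comp C2 → Comp C2 → Comp C2 → ℚ
tailTerm n w q1 p' r = onJust (refineDeg p' r) (λ D → refinementCoeff p' r D * coeff (X n (q1 ++ r)) w)

lin-⋆-expansion : (a1 n' : ℕ) (α' : Comp C2^) (w : Word) (q1 : Comp C2) → IsComp a1 q1 →
  lin (λ u → lin (λ v → coeff (starW u v) w) (expansion n' α')) (X a1 q1)
  ≡ ∑ (λ p' → evalChar α' p' * ∑ (tailTerm (a1 ℕ.+ n') w q1 p') (Γ allC2 n')) (ofShape n' α')
lin-⋆-expansion a1 n' α' w q1 icq = begin
  lin (λ u → lin (cs u) (expansion n' α')) (X a1 q1)                               ≡⟨ lin-cong (λ u → lin-expansion (cs u) n' α') (X a1 q1) ⟩
  lin (λ u → ∑ (λ p' → evalChar α' p' * ∑ (summand u p') Γn') (ofShape n' α')) (X a1 q1)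
    ≡⟨ lin-∑ (λ p' u → evalChar α' p' * ∑ (summand u p') Γn') (ofShape n' α') (X a1 q1) ⟩
  ∑ (λ p' → lin (λ u → evalChar α' p' * ∑ (summand u p') Γn') (X a1 q1)) (ofShape n' α') ≡⟨ ∑-cong over-r (ofShape n' α') ⟩
  ∑ (λ p' → evalChar α' p' * ∑ (tailTerm (a1 ℕ.+ n') w q1 p') Γn') (ofShape n' α') ∎
  where
  Γn' = Γ allC2 n'
  cs : Word → Word → ℚ
  cs u v = coeff (starW u v) w
  summand : Word → Comp C2 → Comp C2 → ℚ
  summand u p' r = onJust (refineDeg p' r) (λ D → refinementCoeff p' r D * lin (cs u) (X n' r))
  term : (p' r : Comp C2) → lin (λ u → summand u p' r) (X a1 q1) ≡ tailTerm (a1 ℕ.+ n') w q1 p' r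
  term p' r = trans (lin-onJust (refineDeg p' r) (λ D u → refinementCoeff p' r D * lin (cs u) (X n' r)) (X a1 q1))
    (onJust-cong (refineDeg p' r) (λ D _ → trans (lin-* (refinementCoeff p' r D) (λ u → lin (cs u) (X n' r)) (X a1 q1))
      (cong (refinementCoeff p' r D *_) (trans (sym (coeff-⋆ (X a1 q1) (X n' r) w)) (X⋆X≈X a1 n' q1 r icq w)))))
  over-r : (p' : Comp C2) → lin (λ u → evalChar α' p' * ∑ (summand u p') Γn') (X a1 q1) ≡ evalChar α' p' * ∑ (tailTerm (a1 ℕ.+ n') w q1 p') Γn'
  over-r p' = trans (lin-* (evalChar α' p') (λ u → ∑ (summand u p') Γn') (X a1 q1))
    (cong (evalChar α' p' *_) (trans (lin-∑ (λ r u → summand u p' r) Γn' (X a1 q1)) (∑-cong (term p') Γn')))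

IsComp-suc⇒nonempty : {a : ℕ} (q : Comp C2) → IsComp (suc a) q → 1 ≤ length q
IsComp-suc⇒nonempty [] (_ , ())
IsComp-suc⇒nonempty (_ ∷ _) _ = s≤s z≤n

refinementCoeff-++ : (a : ℕ) (e : C2) (p' q1 r : Comp C2) (D : ℕ) → 1 ≤ length q1 → refineDeg p' r ≡ just D →
  refinementCoeff ((suc a , e) ∷ p') (q1 ++ r) (length q1 ℕ.* D) ≡ logCoeff q1 * refinementCoeff p' r D
refinementCoeff-++ a e p' q1 r D l1 rd with length q1 | LP.length-++ q1 {r}
... | suc t | eql = begin
  negOnePow (length (q1 ++ r) ∸ suc (length p')) * invℕ (suc t ℕ.* D)
    ≡⟨ cong₂ (λ x y → negOnePow x * y) ex (sym (invℕ-* (suc t) D (s≤s z≤n) D1)) ⟩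
  negOnePow (t ℕ.+ (length r ∸ length p')) * (invℕ (suc t) * invℕ D) ≡⟨ cong (_* (invℕ (suc t) * invℕ D)) (negOnePow-+ t (length r ∸ length p')) ⟩
  (negOnePow t * negOnePow (length r ∸ length p')) * (invℕ (suc t) * invℕ D)
    ≡⟨ re (negOnePow t) (negOnePow (length r ∸ length p')) (invℕ (suc t)) (invℕ D) ⟩
  (negOnePow t * invℕ (suc t)) * (negOnePow (length r ∸ length p') * invℕ D) ∎
  where
  D1 = proj₁ (refineDeg-length p' r rd)
  lpr = proj₂ (refineDeg-length p' r rd)
  ex : length (q1 ++ r) ∸ suc (length p') ≡ t ℕ.+ (length r ∸ length p')
  ex = trans (cong (_∸ suc (length p')) eql) (NP.+-∸-assoc t lpr)
  re : ∀ a b c d → (a * b) * (c * d) ≡ (a * c) * (b * d)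
  re = solve-∀ ℚ-ring

monochrome : C2 → ℕ → List (Comp C2)
monochrome e a = filter (allLabel e) (Γ allC2 a)

monochrome-IsComp : {e : C2} {a : ℕ} {q : Comp C2} → q ∈ monochrome e a → IsComp a q
monochrome-IsComp {e} {a} m = compsAux-sound allC2 a a (proj₁ (∈-filter⁻ (allLabel e) (Γ allC2 a) m))

expansion-cons : (a n' : ℕ) (c : C2^) (α' : Comp C2^) (w : Word) →
  lin (δ w) (expansion (suc a ℕ.+ n') ((suc a , c) ∷ α'))
  ≡ ∑ (λ e → ∑ (λ p' → (chi c e * evalChar α' p') * ∑ (λ q1 → ∑ (λ r → logCoeff q1 * tailTerm (suc a ℕ.+ n') w q1 p' r) (Γ allC2 n')) (monochrome e (suc a))) (ofShape n' α')) allC2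
expansion-cons a n' c α' w = begin
  lin (δ w) (expansion n α) ≡⟨ lin-expansion (δ w) n α ⟩
  ∑ (λ p → evalChar α p * ∑ (λ q → onJust (refineDeg p q) (λ D → refinementCoeff p q D * lin (δ w) (X n q))) Γn) (ofShape n α)
    ≡⟨ ∑-cong (λ p → cong (evalChar α p *_) (∑-cong (λ q → onJust-cong (refineDeg p q) (λ D _ → cong (refinementCoeff p q D *_) (sym (coeff≡lin-δ (X n q) w)))) Γn)) (ofShape n α) ⟩
  ∑ (λ p → evalChar α p * ∑ (term p) Γn) (ofShape n α) ≡⟨ ∑-ofShape-cons a n' c α' (λ p → evalChar α p * ∑ (term p) Γn) ⟩
  ∑ (λ e → ∑ (λ p' → (chi c e * evalChar α' p') * ∑ (term ((suc a , e) ∷ p')) Γn) (ofShape n' α')) allC2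
    ≡⟨ ∑-cong (λ e → ∑-cong (λ p' → cong ((chi c e * evalChar α' p') *_) (inner e p')) (ofShape n' α')) allC2 ⟩
  ∑ (λ e → ∑ (λ p' → (chi c e * evalChar α' p') * ∑ (λ q1 → ∑ (λ r → logCoeff q1 * tailTerm n w q1 p' r) (Γ allC2 n')) (monochrome e (suc a))) (ofShape n' α')) allC2 ∎
  where
  n = suc a ℕ.+ n'
  α = (suc a , c) ∷ α'
  Γn = Γ allC2 n
  term : Comp C2 → Comp C2 → ℚ
  term p q = onJust (refineDeg p q) (λ D → refinementCoeff p q D * coeff (X n q) w)
  inner : (e : C2) (p' : Comp C2) → ∑ (term ((suc a , e) ∷ p')) Γn ≡ ∑ (λ q1 → ∑ (λ r → logCoeff q1 * tailTerm n w q1 p' r) (Γ allC2 n')) (monochrome e (suc a))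
  inner e p' = begin
    ∑ (term P) Γn ≡⟨ ∑-cong (λ q → onJust-refineDeg-cons (suc a) e p' q (λ D → refinementCoeff P q D * coeff (X n q) w)) Γn ⟩
    ∑ (λ q → afterTake 0ℚ (takeSum (suc a) e q) (K q)) Γn ≡⟨ ∑-afterTake (suc a) a n e K (s≤s (NP.m≤m+n a n')) (NP.n<1+n a) ⟩
    ∑ (λ q1 → ∑ (λ r → K (q1 ++ r) (length q1) r) (Γ allC2 (n ∸ suc a))) (monochrome e (suc a))
      ≡⟨ cong (λ k → ∑ (λ q1 → ∑ (λ r → K (q1 ++ r) (length q1) r) (Γ allC2 k)) (monochrome e (suc a))) (NP.m+n∸m≡n (suc a) n') ⟩
    ∑ (λ q1 → ∑ (λ r → K (q1 ++ r) (length q1) r) (Γ allC2 n')) (monochrome e (suc a))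
      ≡⟨ ∑-cong-∈ (monochrome e (suc a)) (λ {q1} mq1 → ∑-cong (λ r → trans (onJust-cong (refineDeg p' r)
            (λ D rd → trans (cong (_* coeff (X n (q1 ++ r)) w) (refinementCoeff-++ a e p' q1 r D (IsComp-suc⇒nonempty q1 (monochrome-IsComp {e} {suc a} mq1)) rd))
                            (QP.*-assoc (logCoeff q1) (refinementCoeff p' r D) (coeff (X n (q1 ++ r)) w))))
            (sym (onJust-* (refineDeg p' r) (logCoeff q1) (λ D → refinementCoeff p' r D * coeff (X n (q1 ++ r)) w)))) (Γ allC2 n')) ⟩
    ∑ (λ q1 → ∑ (λ r → logCoeff q1 * tailTerm n w q1 p' r) (Γ allC2 n')) (monochrome e (suc a)) ∎
    where
    P = (suc a , e) ∷ p'
    K : Comp C2 → ℕ → Comp C2 → ℚ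
    K q d r = onJust (refineDeg p' r) (λ D → refinementCoeff P q (d ℕ.* D) * coeff (X n q) w)

Iα-cons : (a n' : ℕ) (c : C2^) (α' : Comp C2^) (k' : ℕ) → Iα α' ≈A scale (invℕ k') (expansion n' α') → (w : Word) →
  coeff (Iα ((suc a , c) ∷ α')) w ≡ invℕ k' * (½ * ∑ (λ e → chi c e * ∑ (λ q1 → logCoeff q1 * ∑ (λ p' → evalChar α' p' * ∑ (λ r → tailTerm (suc a ℕ.+ n') w q1 p' r) (Γ allC2 n')) (ofShape n' α')) (monochrome e (suc a))) allC2)
Iα-cons a n' c α' k' ih w = begin
  coeff (Ipart x ⋆ Iα α') w ≡⟨ coeff-⋆ (Ipart x) (Iα α') w ⟩
  lin (λ u → lin (cs u) (Iα α')) (Ipart x)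
    ≡⟨ lin-cong (λ u → trans (lin-resp-≈ (cs u) {Iα α'} {scale (invℕ k') (expansion n' α')} ih) (lin-scale (cs u) (invℕ k') (expansion n' α'))) (Ipart x) ⟩
  lin (λ u → invℕ k' * H u) (Ipart x) ≡⟨ lin-* (invℕ k') H (Ipart x) ⟩
  invℕ k' * lin H (Ipart x) ≡⟨ cong (invℕ k' *_) (lin-Ipart H (suc a) c) ⟩
  invℕ k' * (½ * ∑ (λ e → chi c e * lin H (rr e (suc a))) allC2)
    ≡⟨ cong (λ z → invℕ k' * (½ * z)) (∑-cong (λ e → cong (chi c e *_) (trans (lin-rr H e (suc a))
         (∑-cong-∈ (monochrome e (suc a)) (λ {q1} mq1 → cong (logCoeff q1 *_) (lin-⋆-expansion (suc a) n' α' w q1 (monochrome-IsComp {e} {suc a} mq1)))))) allC2) ⟩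
  invℕ k' * (½ * ∑ (λ e → chi c e * ∑ (λ q1 → logCoeff q1 * ∑ (λ p' → evalChar α' p' * ∑ (λ r → tailTerm (suc a ℕ.+ n') w q1 p' r) (Γ allC2 n')) (ofShape n' α')) (monochrome e (suc a))) allC2) ∎
  where
  x = (suc a , c)
  cs : Word → Word → ℚ
  cs u v = coeff (starW u v) w
  H : Word → ℚ
  H u = lin (cs u) (expansion n' α')

∑-rearrange : {A B R : Set} (Q1 : List A) (P' : List B) (Rl : List R) (k : ℚ) (cc : A → ℚ) (ev : B → ℚ) (Z : A → B → R → ℚ) →
  k * ∑ (λ q1 → cc q1 * ∑ (λ p' → ev p' * ∑ (λ r → Z q1 p' r) Rl) P') Q1
  ≡ ∑ (λ p' → (k * ev p') * ∑ (λ q1 → ∑ (λ r → cc q1 * Z q1 p' r) Rl) Q1) P'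
∑-rearrange Q1 P' Rl k cc ev Z = begin
  k * ∑ (λ q1 → cc q1 * ∑ (λ p' → ev p' * ∑ (λ r → Z q1 p' r) Rl) P') Q1
    ≡⟨ cong (k *_) (∑-cong (λ q1 → trans (sym (∑-*ˡ (cc q1) _ P')) (∑-cong (λ p' → trans (re (cc q1) (ev p') (∑ (λ r → Z q1 p' r) Rl))
         (cong (ev p' *_) (sym (∑-*ˡ (cc q1) (λ r → Z q1 p' r) Rl)))) P')) Q1) ⟩
  k * ∑ (λ q1 → ∑ (λ p' → ev p' * ∑ (λ r → cc q1 * Z q1 p' r) Rl) P') Q1
    ≡⟨ cong (k *_) (∑-swap (λ q1 p' → ev p' * ∑ (λ r → cc q1 * Z q1 p' r) Rl) Q1 P') ⟩
  k * ∑ (λ p' → ∑ (λ q1 → ev p' * ∑ (λ r → cc q1 * Z q1 p' r) Rl) Q1) P'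
    ≡⟨ cong (k *_) (∑-cong (λ p' → ∑-*ˡ (ev p') _ Q1) P') ⟩
  k * ∑ (λ p' → ev p' * ∑ (λ q1 → ∑ (λ r → cc q1 * Z q1 p' r) Rl) Q1) P'
    ≡⟨ sym (∑-*ˡ k _ P') ⟩
  ∑ (λ p' → k * (ev p' * ∑ (λ q1 → ∑ (λ r → cc q1 * Z q1 p' r) Rl) Q1)) P'
    ≡⟨ ∑-cong (λ p' → sym (QP.*-assoc k (ev p') _)) P' ⟩
  ∑ (λ p' → (k * ev p') * ∑ (λ q1 → ∑ (λ r → cc q1 * Z q1 p' r) Rl) Q1) P' ∎
  where
  re : ∀ a b c → a * (b * c) ≡ b * (a * c)
  re = solve-∀ ℚ-ring

Iα≈expansion : (α : Comp C2^) (n : ℕ) → IsComp n α → Iα α ≈A scale (invℕ (2 ^ length α)) (expansion n α)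
Iα≈expansion [] n (_ , refl) w = refl
Iα≈expansion ((zero , c) ∷ α') n ((() All.∷ _) , _)
Iα≈expansion ((suc a , c) ∷ α') n ((_ All.∷ al) , refl) w = begin
  coeff (Iα ((suc a , c) ∷ α')) w ≡⟨ Iα-cons a n' c α' (2 ^ k') (Iα≈expansion α' n' (al , refl)) w ⟩
  invℕ (2 ^ k') * (½ * ∑ (λ e → chi c e * LS e) allC2) ≡⟨ re (invℕ (2 ^ k')) ½ _ ⟩
  (½ * invℕ (2 ^ k')) * ∑ (λ e → chi c e * LS e) allC2
    ≡⟨ cong₂ _*_ (invℕ-* 2 (2 ^ k') (s≤s z≤n) (NP.m^n>0 2 k')) (∑-cong (λ e → ∑-rearrange (monochrome e (suc a)) (ofShape n' α') (Γ allC2 n') (chi c e) logCoeff (evalChar α') (tailTerm N w)) allC2) ⟩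
  invℕ (2 ^ suc k') * ∑ (λ e → ∑ (λ p' → (chi c e * evalChar α' p') * ∑ (λ q1 → ∑ (λ r → logCoeff q1 * tailTerm N w q1 p' r) (Γ allC2 n')) (monochrome e (suc a))) (ofShape n' α')) allC2
    ≡⟨ cong (invℕ (2 ^ suc k') *_) (sym (expansion-cons a n' c α' w)) ⟩
  invℕ (2 ^ suc k') * lin (δ w) (expansion N ((suc a , c) ∷ α'))
    ≡⟨ cong (invℕ (2 ^ suc k') *_) (sym (coeff≡lin-δ (expansion N ((suc a , c) ∷ α')) w)) ⟩
  invℕ (2 ^ suc k') * coeff (expansion N ((suc a , c) ∷ α')) w ≡⟨ sym (coeff-scale (invℕ (2 ^ suc k')) (expansion N ((suc a , c) ∷ α')) w) ⟩
  coeff (scale (invℕ (2 ^ suc k')) (expansion N ((suc a , c) ∷ α'))) w ∎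
  where
  n' = sum (map proj₁ α')
  N = suc a ℕ.+ n'
  k' = length α'
  LS : C2 → ℚ
  LS e = ∑ (λ q1 → logCoeff q1 * ∑ (λ p' → evalChar α' p' * ∑ (λ r → tailTerm N w q1 p' r) (Γ allC2 n')) (ofShape n' α')) (monochrome e (suc a))
  re : ∀ a b c → a * (b * c) ≡ (b * a) * c
  re = solve-∀ ℚ-ring

removeOne : ℕ × C2^ → Comp C2^ → Comp C2^
removeOne x [] = []
removeOne x (y ∷ ys) = if does (decC2^ x y) then ys else y ∷ removeOne x ys

count-here : (x : ℕ × C2^) (ys : Comp C2^) → count x (x ∷ ys) ≡ suc (count x ys)
count-here x ys = cong (λ b → if b then suc (count x ys) else count x ys) (dec-true (decC2^ x x) refl)

count-there : {x y : ℕ × C2^} (ys : Comp C2^) → x ≢ y → count x (y ∷ ys) ≡ count x ys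
count-there {x} {y} ys ne = cong (λ b → if b then suc (count x ys) else count x ys) (dec-false (decC2^ x y) ne)

removeOne-here : (x : ℕ × C2^) (ys : Comp C2^) → removeOne x (x ∷ ys) ≡ ys
removeOne-here x ys = cong (λ b → if b then ys else x ∷ removeOne x ys) (dec-true (decC2^ x x) refl)

removeOne-there : {x y : ℕ × C2^} (ys : Comp C2^) → x ≢ y → removeOne x (y ∷ ys) ≡ y ∷ removeOne x ys
removeOne-there {x} {y} ys ne = cong (λ b → if b then ys else y ∷ removeOne x ys) (dec-false (decC2^ x y) ne)

count-pos⇒∈ : (x : ℕ × C2^) (b : Comp C2^) → 1 ≤ count x b → x ∈ b
count-pos⇒∈ x (y ∷ b) l with toSum (decC2^ x y)
... | inj₁ e = here e
... | inj₂ ne = there (count-pos⇒∈ x b (subst (1 ≤_) (count-there b ne) l))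

length-removeOne : (x : ℕ × C2^) (b : Comp C2^) → x ∈ b → suc (length (removeOne x b)) ≡ length b
length-removeOne x (y ∷ b) m with toSum (decC2^ x y)
... | inj₁ refl = cong (λ z → suc (length z)) (removeOne-here x b)
length-removeOne x (y ∷ b) (here e) | inj₂ ne = ⊥-elim (ne e)
length-removeOne x (y ∷ b) (there m) | inj₂ ne = trans (cong (λ z → suc (length z)) (removeOne-there b ne)) (cong suc (length-removeOne x b m))

count-removeOne-same : (x : ℕ × C2^) (b : Comp C2^) → x ∈ b → count x b ≡ suc (count x (removeOne x b))
count-removeOne-same x (y ∷ b) m with toSum (decC2^ x y)
count-removeOne-same x (y ∷ b) m | inj₁ refl = trans (count-here x b) (cong (λ z → suc (count x z)) (sym (removeOne-here x b)))
count-removeOne-same x (y ∷ b) (here e) | inj₂ ne = ⊥-elim (ne e)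
count-removeOne-same x (y ∷ b) (there m) | inj₂ ne = trans (count-there b ne) (trans (count-removeOne-same x b m) (cong suc (sym (trans (cong (count x) (removeOne-there b ne)) (count-there (removeOne x b) ne)))))

count-removeOne-other : (x z : ℕ × C2^) (b : Comp C2^) → z ≢ x → count z b ≡ count z (removeOne x b)
count-removeOne-other x z [] ne = refl
count-removeOne-other x z (y ∷ b) ne with toSum (decC2^ x y)
... | inj₁ refl = trans (count-there b ne) (cong (count z) (sym (removeOne-here x b)))
... | inj₂ nxy with toSum (decC2^ z y)
...   | inj₁ refl = trans (count-here z b) (trans (cong suc (count-removeOne-other x z b ne)) (sym (trans (cong (count z) (removeOne-there b nxy)) (count-here z (removeOne x b)))))
...   | inj₂ nzy = trans (count-there b nzy) (trans (count-removeOne-other x z b ne) (sym (trans (cong (count z) (removeOne-there b nxy)) (count-there (removeOne x b) nzy))))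

removeOne-⊆ : (x : ℕ × C2^) (b : Comp C2^) {z : ℕ × C2^} → z ∈ removeOne x b → z ∈ b
removeOne-⊆ x (y ∷ b) {z} m with toSum (decC2^ x y)
... | inj₁ refl = there (subst (z ∈_) (removeOne-here x b) m)
... | inj₂ ne with subst (z ∈_) (removeOne-there b ne) m
...   | here e = here e
...   | there m' = there (removeOne-⊆ x b m')

count≡⇒length≡ : (a b : Comp C2^) → (∀ {x} → x ∈ a ++ b → count x a ≡ count x b) → length a ≡ length b
count≡⇒length≡ [] [] h = refl
count≡⇒length≡ [] (y ∷ b) h with trans (h (here refl)) (count-here y b)
... | ()
count≡⇒length≡ (x ∷ a) b h = trans (cong suc (count≡⇒length≡ a b' h')) (length-removeOne x b xb)
  where
  xb : x ∈ b
  xb = count-pos⇒∈ x b (subst (1 ≤_) (trans (sym (count-here x a)) (h (here refl))) (s≤s z≤n))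
  b' = removeOne x b
  h' : ∀ {z} → z ∈ a ++ b' → count z a ≡ count z b'
  h' {z} m with toSum (decC2^ z x)
  ... | inj₁ refl = NP.suc-injective (trans (sym (count-here z a)) (trans (h (here refl)) (count-removeOne-same z b xb)))
  ... | inj₂ ne = trans (sym (count-there a ne)) (trans (h (there mm)) (count-removeOne-other x z b ne))
    where
    mm : z ∈ a ++ b
    mm with ∈-++⁻ a m
    ... | inj₁ ma = ∈-++⁺ˡ ma
    ... | inj₂ mb = ∈-++⁺ʳ a (removeOne-⊆ x b mb)

all-sound : {A : Set} (f : A → Bool) (L : List A) → all f L ≡ true → ∀ {x} → x ∈ L → f x ≡ true
all-sound f (y ∷ L) e m with f y in eq
all-sound f (y ∷ L) e (here refl) | true = eq
all-sound f (y ∷ L) e (there m) | true = all-sound f L e m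

sameSupp⇒length≡ : (lm α : Comp C2^) → sameSupp lm α ≡ true → length lm ≡ length α
sameSupp⇒length≡ lm α e = count≡⇒length≡ lm α (λ {x} m → NP.≡ᵇ⇒≡ (count x lm) (count x α) (subst T (sym (all-sound _ (lm ++ α) e m)) _))

rhsWith : ℕ → Comp C2^ → (Comp C2 → Comp C2 → Alg) → Alg
rhsWith n lm summand =
  scale (invℕ (2 ^ length lm ℕ.* length lm !))
    (concatMap (λ α → concatMap (λ p → scale (evalChar α p) (concatMap (summand p) (Γ allC2 n))) (ofShape n α))
      (filter (sameSupp lm) (Γ allC2^ n)))

-- Names the summand that `rhs` builds from a `where`-bound function (found by unification).
rhs-summand : Σ (ℕ → Comp C2^ → Comp C2 → Comp C2 → Alg) λ summand → ∀ n lm → rhs n lm ≡ rhsWith n lm (summand n lm)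
rhs-summand = _ , λ _ _ → refl

rhs≡ : (n : ℕ) (lm : Comp C2^) →
  rhs n lm ≡ scale (invℕ (2 ^ length lm ℕ.* length lm !)) (concatMap (expansion n) (filter (sameSupp lm) (Γ allC2^ n)))
rhs≡ n lm = trans (proj₂ rhs-summand n lm) (cong (scale (invℕ (2 ^ length lm ℕ.* length lm !))) (cong concat (LP.map-cong (λ α →
  cong concat (LP.map-cong (λ p → cong (scale (evalChar α p)) (cong concat (LP.map-cong (summand≡ p) (Γ allC2 n)))) (ofShape n α)))
    (filter (sameSupp lm) (Γ allC2^ n)))))
  where
  summand≡ : (p q : Comp C2) → proj₁ rhs-summand n lm p q ≡ refinementTerm n p q (refineDeg p q)
  summand≡ p q with refineDeg p q
  ... | nothing = refl
  ... | just _ = refl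

corollary7p15 : (n : ℕ) (lm : Comp C2^) → IsComp n lm →
    vazirani n lm ≈A rhs n lm
corollary7p15 n lm _ w = begin
  coeff (vazirani n lm) w                                    ≡⟨ coeff-scale-concatMap (invℕ (ℓ !)) Iα As w ⟩
  invℕ (ℓ !) * ∑ (λ α → coeff (Iα α) w) As                   ≡⟨ cong (invℕ (ℓ !) *_) (∑-cong-∈ As coeff-Iα) ⟩
  invℕ (ℓ !) * ∑ (λ α → invℕ (2 ^ ℓ) * E α) As               ≡⟨ cong (invℕ (ℓ !) *_) (∑-*ˡ (invℕ (2 ^ ℓ)) E As) ⟩
  invℕ (ℓ !) * (invℕ (2 ^ ℓ) * ∑ E As)                       ≡⟨ sym (QP.*-assoc (invℕ (ℓ !)) (invℕ (2 ^ ℓ)) (∑ E As)) ⟩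
  (invℕ (ℓ !) * invℕ (2 ^ ℓ)) * ∑ E As                       ≡⟨ cong (_* ∑ E As) (QP.*-comm (invℕ (ℓ !)) (invℕ (2 ^ ℓ))) ⟩
  (invℕ (2 ^ ℓ) * invℕ (ℓ !)) * ∑ E As                       ≡⟨ cong (_* ∑ E As) (invℕ-* (2 ^ ℓ) (ℓ !) (NP.m^n>0 2 ℓ) (NP.1≤n! ℓ)) ⟩
  invℕ (2 ^ ℓ ℕ.* ℓ !) * ∑ E As                              ≡⟨ coeff-scale-concatMap (invℕ (2 ^ ℓ ℕ.* ℓ !)) (expansion n) As w ⟨
  coeff (scale (invℕ (2 ^ ℓ ℕ.* ℓ !)) (concatMap (expansion n) As)) w ≡⟨ cong (λ A → coeff A w) (rhs≡ n lm) ⟨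
  coeff (rhs n lm) w ∎
  where
  ℓ = length lm
  As = filter (sameSupp lm) (Γ allC2^ n)
  E : Comp C2^ → ℚ
  E α = coeff (expansion n α) w
  coeff-Iα : ∀ {α} → α ∈ As → coeff (Iα α) w ≡ invℕ (2 ^ ℓ) * E α
  coeff-Iα {α} m with ∈-filter⁻ (sameSupp lm) (Γ allC2^ n) m
  ... | α∈Γ , same rewrite sameSupp⇒length≡ lm α same =
    trans (Iα≈expansion α n (compsAux-sound allC2^ n n α∈Γ) w) (coeff-scale (invℕ (2 ^ length α)) (expansion n α) w)
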